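{- Let $G$ be a finite graph possibly with loops (but no parallel edges). (1) If $\varphi$ and $\varphi'$ are sequences of operations, each operation being either a local complementation or a pivot, both applicable to $G$, and $\sup(\varphi)=\sup(\varphi')$, then $G\varphi=G\varphi'$. (2) For $S\subseteq V(G)$, $\det(G|_S)=1$ if and only if there exists a sequence $\varphi$ of local complementations and pivots with $\sup(\varphi)=S$ that is applicable to $G$; moreover such a $\varphi$ can be chosen to be reduced.
   Context: The adjacency matrix of a graph with loops is the symmetric $(0,1)$-matrix with $a_{x,y}=1$ iff $\{x,y\}$ is an edge and $a_{x,x}=1$ iff $x$ has a loop; $\det H$ is its determinant over $GF(2)$ (empty determinant $=1$); $G|_S$ is the induced subgraph. Local complementation $*u$ is defined only when $u$ has a loop: $G*u$ toggles the edge $\{v,w\}$ for all distinct $v,w\in N_G(u)\setminus\{u\}$ and toggles the loop at every $v\in N_G(u)\setminus\{u\}$. Pivot $[uv]$ is defined only when $\{u,v\}$ is an edge, $u\neq v$, and neither $u$ nor $v$ has a loop: with $N'(x)=N(x)\cup\{x\}$ (neighbourhoods among distinct vertices), $V_1=N'(u)\setminus N'(v)$, $V_2=N'(v)\setminus N'(u)$, $V_3=N'(u)\cap N'(v)$, $G[uv]$ toggles every pair $\{x,y\}$ with $x\in V_i$, $y\in V_j$, $i\neq j$, and does not change any loop. A sequence of such operations is applicable to $G$ if each operation is defined on the graph obtained by applying the preceding ones; $G\varphi$ is the result. The support $\sup(\varphi)$ is the symmetric difference of the sets $\{u\}$ over all local complementations $*u$ and $\{u,v\}$ over all pivots $[uv]$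 in $\varphi$, i.e. the set of vertices occurring an odd number of times. A sequence is reduced if no vertex occurs more than once in it. -}

module Defs where

open import Data.Nat using (ℕ; zero; suc)
open import Data.Bool using (Bool; true; false; _∧_; _∨_; not; _xor_; if_then_else_)
open import Data.Fin using (Fin; zero; suc; punchIn; _≟_)
open import Data.Fin.Subset using (Subset; ⁅_⁆; ⊥)
import Data.List
open import Data.List using (List; []; _∷_; foldr; map; filter; length; allFin; lookup)
open import Data.List.Relation.Unary.Unique.Propositional using (Unique)
open import Data.Vec using (zipWith)
import Data.Vec
open import Relation.Nullary using (¬_)
open import Relation.Nullary.Decidable using (⌊_⌋)
open import Relation.Binary.PropositionalEquality using (_≡_; _≢_)
open import Data.Product using (_×_)

-- A graph with loops on the vertex set Fin n, given by its adjacency matrix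
-- (a (0,1)-matrix = Bool-valued matrix). Symmetry is a separate predicate.
Graph : ℕ → Set
Graph n = Fin n → Fin n → Bool

Symmetric : ∀ {n} → Graph n → Set
Symmetric G = ∀ x y → G x y ≡ G y x

_≈G_ : ∀ {n} → Graph n → Graph n → Set
G ≈G H = ∀ x y → G x y ≡ H x y

_==_ : ∀ {n} → Fin n → Fin n → Bool
x == y = ⌊ x ≟ y ⌋

_!=_ : ∀ {n} → Fin n → Fin n → Bool
x != y = not (x == y)

-- Local complementation *u (defined only when u has a loop).
-- Toggles the edge {v,w} for distinct v,w ∈ N(u)\{u}, and the loop at every
-- v ∈ N(u)\{u}.
localComp : ∀ {n} → Graph n → Fin n → Graph n
localComp G u x y =
  if x == y
  then G x x xor (x != u ∧ G u x)
  else G x y xor (x != u ∧ y != u ∧ G u x ∧ G u y)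

LCDefined : ∀ {n} → Graph n → Fin n → Set
LCDefined G u = G u u ≡ true

-- Pivot [uv] (defined only when {u,v} is an edge, u ≠ v, no loops at u, v).
-- N'(x) = N(x) ∪ {x}, with N(x) the neighbourhood among distinct vertices.
N' : ∀ {n} → Graph n → Fin n → Fin n → Bool
N' G x z = (z == x) ∨ (z != x ∧ G x z)

data Class : Set where
  c1 c2 c3 none : Class

classOf : ∀ {n} → Graph n → Fin n → Fin n → Fin n → Class
classOf G u v x with N' G u x | N' G v x
... | true  | false = c1
... | false | true  = c2
... | true  | true  = c3
... | false | false = none

differentClasses : Class → Class → Bool
differentClasses c1 c2 = true
differentClasses c1 c3 = true
differentClasses c2 c1 = true
differentClasses c2 c3 = true
differentClasses c3 c1 = true
differentClasses c3 c2 = true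
differentClasses _ _ = false

pivot : ∀ {n} → Graph n → Fin n → Fin n → Graph n
pivot G u v x y =
  G x y xor differentClasses (classOf G u v x) (classOf G u v y)

PivotDefined : ∀ {n} → Graph n → Fin n → Fin n → Set
PivotDefined G u v = G u v ≡ true × u ≢ v × G u u ≡ false × G v v ≡ false

data Op (n : ℕ) : Set where
  lc  : Fin n → Op n
  piv : Fin n → Fin n → Op n

-- G ⟶[ φ ] H : φ is applicable to G and Gφ = H.
data _⟶[_]_ {n : ℕ} : Graph n → List (Op n) → Graph n → Set where
  done : ∀ {G} → G ⟶[ [] ] G
  stepLC : ∀ {G H u φ} → LCDefined G u →
           localComp G u ⟶[ φ ] H → G ⟶[ lc u ∷ φ ] H
  stepPiv : ∀ {G H u v φ} → PivotDefined G u v →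
            pivot G u v ⟶[ φ ] H → G ⟶[ piv u v ∷ φ ] H

_⊕_ : ∀ {n} → Subset n → Subset n → Subset n
_⊕_ = zipWith _xor_

opSupport : ∀ {n} → Op n → Subset n
opSupport (lc u) = ⁅ u ⁆
opSupport (piv u v) = ⁅ u ⁆ ⊕ ⁅ v ⁆

sup : ∀ {n} → List (Op n) → Subset n
sup [] = ⊥
sup (o ∷ φ) = opSupport o ⊕ sup φ

opVertices : ∀ {n} → Op n → List (Fin n)
opVertices (lc u) = u ∷ []
opVertices (piv u v) = u ∷ v ∷ []

vertices : ∀ {n} → List (Op n) → List (Fin n)
vertices [] = []
vertices (o ∷ φ) = Data.List._++_ (opVertices o) (vertices φ)

Reduced : ∀ {n} → List (Op n) → Set
Reduced φ = Unique (vertices φ)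

-- Determinant over GF(2) of a square (0,1)-matrix, by Laplace expansion
-- along the first row (signs are irrelevant in characteristic 2).
det : ∀ {k} → (Fin k → Fin k → Bool) → Bool
det {zero} M = true
det {suc k} M =
  foldr _xor_ false
    (map (λ j → M zero j ∧ det (λ a b → M (suc a) (punchIn j b))) (allFin (suc k)))

elems : ∀ {n} → Subset n → List (Fin n)
elems {n} S = filter (λ i → T? (Data.Vec.lookup S i)) (allFin n)
  where open import Data.Bool using (T?)

induced : ∀ {n} → Graph n → (S : Subset n) → Fin (length (elems S)) → Fin (length (elems S)) → Bool
induced G S i j = G (lookup (elems S) i) (lookup (elems S) j)

module Submission where

-- View adjacency matrices over GF(2).  Say B is an exchange of A on X
-- (`Exchange A X B`) if B maps mix X (A x) x to mix X x (A x) for every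
-- vector x, i.e. B is A with inputs and outputs swapped on the coordinates
-- in X: the principal pivot transform A * X.  Exchanges compose along
-- symmetric differences and are unique when they exist.  A local
-- complementation *u is the exchange on {u} and a pivot [uv] the exchange
-- on {u, v}, so an applicable sequence φ produces the exchange on sup φ:
-- this gives part (1), and shows that G[sup φ] is nonsingular.  Conversely,
-- when G[S] is nonsingular a greedy construction (local complementation at a
-- looped vertex of S, otherwise a pivot on an edge inside S) yields a reduced
-- applicable sequence with support S.  Part (2) then only needs that
-- det (G|S) = 1 iff G[S] is nonsingular, which follows from `det-dichotomy`:
-- over GF(2) the Laplace-expansion determinant is 1 exactly for invertible
-- matrices (proved by column elimination).

open import Defs
open import Data.Nat using (ℕ; zero; suc; _+_; _≤_; _<_; s≤s; z≤n)
open import Data.Nat.Properties using (+-suc; ≤-trans; ≤-refl; ≤-pred; m≤n+m; m<m+n; <⇒≱)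
open import Data.Bool using (Bool; true; false; _∧_; not; _xor_; if_then_else_; T?)
import Data.Bool as Bool
open import Data.Bool.Properties
  using (xor-assoc; xor-comm; xor-same; xor-identityʳ; ∧-assoc; ∧-comm; ∧-zeroʳ; ∧-identityʳ;
         ∧-distribˡ-xor; ∧-distribʳ-xor; ∧-conicalˡ; ∧-conicalʳ; ∧-idem; ¬-not; T-≡)
open import Data.Fin using (Fin; zero; suc; punchIn; punchOut; _≟_)
open import Data.Fin.Properties using (suc-injective; punchIn-punchOut; punchInᵢ≢i; punchIn-injective; any?)
open import Data.Fin.Subset using (Subset; ⁅_⁆)
import Data.Vec as Vec
import Data.Vec.Properties as Vec
open import Data.Vec.Functional using (insertAt)
open import Data.Vec.Functional.Properties using (insertAt-lookup; insertAt-punchIn)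
open import Data.List using (List; []; _∷_; foldr; tabulate; map; filter; length; lookup; allFin)
open import Data.List.Properties using (map-tabulate)
open import Data.List.Membership.Propositional using (_∈_)
open import Data.List.Membership.Propositional.Properties using (∈-filter⁺; ∈-filter⁻; ∈-lookup; ∈-allFin)
open import Data.List.Relation.Unary.Any using (index)
open import Data.List.Relation.Unary.Any.Properties using (lookup-index)
open import Data.List.Relation.Unary.All using (All; []; _∷_)
import Data.List.Relation.Unary.All as All
import Data.List.Relation.Unary.All.Properties as All
open import Data.List.Relation.Unary.AllPairs using ([]; _∷_)
open import Data.List.Relation.Unary.Unique.Propositional using (Unique)
import Data.List.Relation.Unary.Unique.Propositional.Properties as Unique
open import Data.List.Relation.Binary.Disjoint.Propositional using (Disjoint)
open import Data.Empty using (⊥; ⊥-elim)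
open import Data.Sum using (_⊎_; inj₁; inj₂)
open import Data.Product using (Σ; ∃; _×_; _,_; proj₁; proj₂)
open import Function using (_∘_; id)
open import Function.Bundles using (Equivalence)
open import Relation.Nullary using (Dec; yes; no)
open import Relation.Binary.PropositionalEquality
open ≡-Reasoning

xor-cancelʳ : ∀ a b → (a xor b) xor b ≡ a
xor-cancelʳ a b = begin
  (a xor b) xor b  ≡⟨ xor-assoc a b b ⟩
  a xor (b xor b)  ≡⟨ cong (a xor_) (xor-same b) ⟩
  a xor false      ≡⟨ xor-identityʳ a ⟩
  a                ∎

xor-cancelˡ : ∀ a b → a xor (a xor b) ≡ b
xor-cancelˡ a b = trans (sym (xor-assoc a a b)) (cong (_xor b) (xor-same a))

xor-cancel-middle : ∀ a b → b xor (a xor b) ≡ a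
xor-cancel-middle a b = trans (cong (b xor_) (xor-comm a b)) (xor-cancelˡ b a)

xor-swap-last : ∀ a b c → (a xor b) xor c ≡ (a xor c) xor b
xor-swap-last a b c = trans (xor-assoc a b c) (trans (cong (a xor_) (xor-comm b c)) (sym (xor-assoc a c b)))

xor-interchange : ∀ a b c d → (a xor b) xor (c xor d) ≡ (a xor c) xor (b xor d)
xor-interchange a b c d = begin
  (a xor b) xor (c xor d)  ≡⟨ xor-assoc a b (c xor d) ⟩
  a xor (b xor (c xor d))  ≡⟨ cong (a xor_) (sym (xor-assoc b c d)) ⟩
  a xor ((b xor c) xor d)  ≡⟨ cong (λ t → a xor (t xor d)) (xor-comm b c) ⟩
  a xor ((c xor b) xor d)  ≡⟨ cong (a xor_) (xor-assoc c b d) ⟩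
  a xor (c xor (b xor d))  ≡⟨ sym (xor-assoc a c (b xor d)) ⟩
  (a xor c) xor (b xor d)  ∎

==-refl : ∀ {n} (x : Fin n) → (x == x) ≡ true
==-refl x with x ≟ x
... | yes _ = refl
... | no x≢x = ⊥-elim (x≢x refl)

==-≢ : ∀ {n} {x y : Fin n} → x ≢ y → (x == y) ≡ false
==-≢ {x = x} {y} x≢y with x ≟ y
... | yes x≡y = ⊥-elim (x≢y x≡y)
... | no _ = refl

==-≡ : ∀ {n} {x y : Fin n} → (x == y) ≡ true → x ≡ y
==-≡ {x = x} {y} x==y with x ≟ y
... | yes x≡y = x≡y

!=-≢ : ∀ {n} {x y : Fin n} → (x != y) ≡ true → x ≢ y
!=-≢ {x = x} x!=x refl with trans (sym x!=x) (cong not (==-refl x))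
... | ()

singleton⊆ : ∀ {n} (X : Fin n → Bool) {u : Fin n} → X u ≡ true → ∀ i → (i == u) ≡ true → X i ≡ true
singleton⊆ X Xu i i==u = subst (λ k → X k ≡ true) (sym (==-≡ i==u)) Xu

==-sym : ∀ {n} (x y : Fin n) → (x == y) ≡ (y == x)
==-sym x y with x ≟ y
... | yes refl = sym (==-refl x)
... | no x≢y = sym (==-≢ (x≢y ∘ sym))

==-suc : ∀ {n} (x y : Fin n) → (suc x == suc y) ≡ (x == y)
==-suc x y = by-cases (x ≟ y)
  where
  by-cases : Dec (x ≡ y) → (suc x == suc y) ≡ (x == y)
  by-cases (yes refl) = trans (==-refl (suc x)) (sym (==-refl x))
  by-cases (no x≢y) = trans (==-≢ (x≢y ∘ suc-injective)) (sym (==-≢ x≢y))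

⨁ : ∀ {n} → (Fin n → Bool) → Bool
⨁ {zero} f = false
⨁ {suc n} f = f zero xor ⨁ (f ∘ suc)

⨁-cong : ∀ {n} {f g : Fin n → Bool} → (∀ i → f i ≡ g i) → ⨁ f ≡ ⨁ g
⨁-cong {zero} f≗g = refl
⨁-cong {suc n} f≗g = cong₂ _xor_ (f≗g zero) (⨁-cong (f≗g ∘ suc))

⨁-zero : ∀ {n} (f : Fin n → Bool) → (∀ i → f i ≡ false) → ⨁ f ≡ false
⨁-zero {zero} f f≗0 = refl
⨁-zero {suc n} f f≗0 = cong₂ _xor_ (f≗0 zero) (⨁-zero (f ∘ suc) (f≗0 ∘ suc))

⨁-xor : ∀ {n} (f g : Fin n → Bool) → ⨁ (λ i → f i xor g i) ≡ ⨁ f xor ⨁ g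
⨁-xor {zero} f g = refl
⨁-xor {suc n} f g = begin
  (f zero xor g zero) xor ⨁ (λ i → f (suc i) xor g (suc i))
    ≡⟨ cong ((f zero xor g zero) xor_) (⨁-xor (f ∘ suc) (g ∘ suc)) ⟩
  (f zero xor g zero) xor (⨁ (f ∘ suc) xor ⨁ (g ∘ suc))
    ≡⟨ xor-interchange (f zero) (g zero) _ _ ⟩
  (f zero xor ⨁ (f ∘ suc)) xor (g zero xor ⨁ (g ∘ suc)) ∎

⨁-scaleˡ : ∀ {n} a (f : Fin n → Bool) → ⨁ (λ i → a ∧ f i) ≡ a ∧ ⨁ f
⨁-scaleˡ {zero} a f = sym (∧-zeroʳ a)
⨁-scaleˡ {suc n} a f =
  trans (cong ((a ∧ f zero) xor_) (⨁-scaleˡ a (f ∘ suc))) (sym (∧-distribˡ-xor a (f zero) _))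

⨁-scaleʳ : ∀ {n} a (f : Fin n → Bool) → ⨁ (λ i → f i ∧ a) ≡ ⨁ f ∧ a
⨁-scaleʳ a f = begin
  ⨁ (λ i → f i ∧ a)  ≡⟨ ⨁-cong (λ i → ∧-comm (f i) a) ⟩
  ⨁ (λ i → a ∧ f i)  ≡⟨ ⨁-scaleˡ a f ⟩
  a ∧ ⨁ f            ≡⟨ ∧-comm a (⨁ f) ⟩
  ⨁ f ∧ a            ∎

⨁-punchIn : ∀ {n} (j : Fin (suc n)) (f : Fin (suc n) → Bool) → ⨁ f ≡ f j xor ⨁ (f ∘ punchIn j)
⨁-punchIn zero f = refl
⨁-punchIn {suc n} (suc j) f = begin
  f zero xor ⨁ (f ∘ suc)
    ≡⟨ cong (f zero xor_) (⨁-punchIn j (f ∘ suc)) ⟩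
  f zero xor (f (suc j) xor ⨁ (f ∘ suc ∘ punchIn j))
    ≡⟨ sym (xor-assoc (f zero) _ _) ⟩
  (f zero xor f (suc j)) xor ⨁ (f ∘ suc ∘ punchIn j)
    ≡⟨ cong (_xor ⨁ (f ∘ suc ∘ punchIn j)) (xor-comm (f zero) (f (suc j))) ⟩
  (f (suc j) xor f zero) xor ⨁ (f ∘ suc ∘ punchIn j)
    ≡⟨ xor-assoc (f (suc j)) (f zero) _ ⟩
  f (suc j) xor ⨁ (f ∘ punchIn (suc j)) ∎

⨁-only : ∀ {n} (k : Fin n) (f : Fin n → Bool) → (∀ i → i ≢ k → f i ≡ false) → ⨁ f ≡ f k
⨁-only {suc n} k f f≗0 = begin
  ⨁ f                               ≡⟨ ⨁-punchIn k f ⟩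
  f k xor ⨁ (f ∘ punchIn k)         ≡⟨ cong (f k xor_) (⨁-zero _ (λ b → f≗0 _ (punchInᵢ≢i k b))) ⟩
  f k xor false                     ≡⟨ xor-identityʳ (f k) ⟩
  f k                               ∎

⨁-unitˡ : ∀ {n} (k : Fin n) (f : Fin n → Bool) → ⨁ (λ i → (i == k) ∧ f i) ≡ f k
⨁-unitˡ k f = trans (⨁-only k _ (λ i i≢k → cong (_∧ f i) (==-≢ i≢k)))
                    (cong (_∧ f k) (==-refl k))

⨁-unitʳ : ∀ {n} (k : Fin n) (f : Fin n → Bool) → ⨁ (λ i → f i ∧ (i == k)) ≡ f k
⨁-unitʳ k f = trans (⨁-cong (λ i → ∧-comm (f i) (i == k))) (⨁-unitˡ k f)

⨁-swap : ∀ {n m} (f : Fin n → Fin m → Bool) → ⨁ (λ i → ⨁ (f i)) ≡ ⨁ (λ j → ⨁ (λ i → f i j))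
⨁-swap {zero} {m} f = sym (⨁-zero {m} (λ _ → false) (λ _ → refl))
⨁-swap {suc n} f = trans (cong (⨁ (f zero) xor_) (⨁-swap (f ∘ suc)))
                         (sym (⨁-xor (f zero) (λ j → ⨁ (λ i → f (suc i) j))))

⨁-pair : ∀ {n} (c d : Fin n) (f : Fin n → Bool) → c ≢ d →
         (∀ i → i ≢ c → i ≢ d → f i ≡ false) → ⨁ f ≡ f c xor f d
⨁-pair {suc n} c d f c≢d f≗0 = begin
  ⨁ f                                 ≡⟨ ⨁-punchIn c f ⟩
  f c xor ⨁ (f ∘ punchIn c)           ≡⟨ cong (f c xor_) (⨁-only d' (f ∘ punchIn c) rest) ⟩
  f c xor f (punchIn c d')            ≡⟨ cong (λ i → f c xor f i) (punchIn-punchOut c≢d) ⟩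
  f c xor f d                         ∎
  where
  d' : Fin n
  d' = punchOut c≢d
  rest : ∀ b → b ≢ d' → f (punchIn c b) ≡ false
  rest b b≢d' = f≗0 _ (punchInᵢ≢i c b)
    (λ e → b≢d' (punchIn-injective c b d' (trans e (sym (punchIn-punchOut c≢d)))))

sumList : List Bool → Bool
sumList = foldr _xor_ false

⨁-lookup : ∀ {A : Set} (f : A → Bool) (L : List A) → ⨁ (f ∘ lookup L) ≡ sumList (map f L)
⨁-lookup f [] = refl
⨁-lookup f (a ∷ L) = cong (f a xor_) (⨁-lookup f L)

⨁-allFin : ∀ {n} (f : Fin n → Bool) → ⨁ f ≡ sumList (map f (allFin n))
⨁-allFin {n} f = trans (⨁-tabulate f) (cong sumList (sym (map-tabulate id f)))
  where
  ⨁-tabulate : ∀ {n} (f : Fin n → Bool) → ⨁ f ≡ sumList (tabulate f)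
  ⨁-tabulate {zero} f = refl
  ⨁-tabulate {suc n} f = cong (f zero xor_) (⨁-tabulate (f ∘ suc))

infixl 7 _·_
_·_ : ∀ {m k} → (Fin m → Fin k → Bool) → (Fin k → Bool) → Fin m → Bool
(M · x) r = ⨁ (λ c → M r c ∧ x c)

·-congʳ : ∀ {m k} (M : Fin m → Fin k → Bool) {x y : Fin k → Bool} →
          (∀ c → x c ≡ y c) → ∀ r → (M · x) r ≡ (M · y) r
·-congʳ M x≗y r = ⨁-cong (λ c → cong (M r c ∧_) (x≗y c))

·-congˡ : ∀ {m k} {M N : Fin m → Fin k → Bool} (x : Fin k → Bool) →
          (∀ r c → M r c ≡ N r c) → ∀ r → (M · x) r ≡ (N · x) r
·-congˡ x M≗N r = ⨁-cong (λ c → cong (_∧ x c) (M≗N r c))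

·-add-unit : ∀ {m k} (M : Fin m → Fin k → Bool) (x : Fin k → Bool) j s r →
             (M · (λ c → x c xor ((c == j) ∧ s))) r ≡ (M · x) r xor (M r j ∧ s)
·-add-unit M x j s r = begin
  ⨁ (λ c → M r c ∧ (x c xor ((c == j) ∧ s)))
    ≡⟨ ⨁-cong (λ c → ∧-distribˡ-xor (M r c) (x c) _) ⟩
  ⨁ (λ c → (M r c ∧ x c) xor (M r c ∧ ((c == j) ∧ s)))
    ≡⟨ ⨁-xor (λ c → M r c ∧ x c) (λ c → M r c ∧ ((c == j) ∧ s)) ⟩
  (M · x) r xor ⨁ (λ c → M r c ∧ ((c == j) ∧ s))
    ≡⟨ cong ((M · x) r xor_) (⨁-cong (λ c → sym (∧-assoc (M r c) (c == j) s))) ⟩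
  (M · x) r xor ⨁ (λ c → (M r c ∧ (c == j)) ∧ s)
    ≡⟨ cong ((M · x) r xor_) (trans (⨁-scaleʳ s (λ c → M r c ∧ (c == j))) (cong (_∧ s) (⨁-unitʳ j (M r)))) ⟩
  (M · x) r xor (M r j ∧ s) ∎

·-rank-one : ∀ {m k} (M : Fin m → Fin k → Bool) (α : Fin m → Bool) (β w : Fin k → Bool) r →
             ((λ r c → M r c xor (α r ∧ β c)) · w) r ≡ (M · w) r xor (α r ∧ ⨁ (λ c → β c ∧ w c))
·-rank-one M α β w r = begin
  ⨁ (λ c → (M r c xor (α r ∧ β c)) ∧ w c)
    ≡⟨ ⨁-cong (λ c → ∧-distribʳ-xor (w c) (M r c) _) ⟩
  ⨁ (λ c → (M r c ∧ w c) xor ((α r ∧ β c) ∧ w c))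
    ≡⟨ ⨁-xor (λ c → M r c ∧ w c) (λ c → (α r ∧ β c) ∧ w c) ⟩
  (M · w) r xor ⨁ (λ c → (α r ∧ β c) ∧ w c)
    ≡⟨ cong ((M · w) r xor_) (⨁-cong (λ c → ∧-assoc (α r) (β c) (w c))) ⟩
  (M · w) r xor ⨁ (λ c → α r ∧ (β c ∧ w c))
    ≡⟨ cong ((M · w) r xor_) (⨁-scaleˡ (α r) (λ c → β c ∧ w c)) ⟩
  (M · w) r xor (α r ∧ ⨁ (λ c → β c ∧ w c)) ∎

search : ∀ {n} (f : Fin n → Bool) → (∃ λ i → f i ≡ true) ⊎ (∀ i → f i ≡ false)
search f with any? (λ i → f i Bool.≟ true)
... | yes found = inj₁ found
... | no ¬found = inj₂ (λ i → ¬-not (λ fi → ¬found (i , fi)))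

-- The number of true entries; the termination measure of column
-- elimination and of the greedy construction of operation sequences.
count : ∀ {n} → (Fin n → Bool) → ℕ
count {zero} f = 0
count {suc n} f = (if f zero then 1 else 0) + count (f ∘ suc)

count-cong : ∀ {n} {f g : Fin n → Bool} → (∀ i → f i ≡ g i) → count f ≡ count g
count-cong {zero} f≗g = refl
count-cong {suc n} f≗g = cong₂ (λ b m → (if b then 1 else 0) + m) (f≗g zero) (count-cong (f≗g ∘ suc))

_minus_ : ∀ {n} → (Fin n → Bool) → (Fin n → Bool) → Fin n → Bool
(X minus Y) i = X i ∧ not (Y i)

minus-inside : ∀ {n} (X Y : Fin n → Bool) {i} → Y i ≡ true → (X minus Y) i ≡ false
minus-inside X Y {i} Yi = trans (cong (λ b → X i ∧ not b) Yi) (∧-zeroʳ (X i))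

minus-outside : ∀ {n} (X Y : Fin n → Bool) {i} → Y i ≡ false → (X minus Y) i ≡ X i
minus-outside X Y {i} Yi = trans (cong (λ b → X i ∧ not b) Yi) (∧-identityʳ (X i))

count-minus : ∀ {n} (X Y : Fin n → Bool) → (∀ i → Y i ≡ true → X i ≡ true) →
              count (X minus Y) + count Y ≡ count X
count-minus {zero} X Y Y⊆X = refl
count-minus {suc n} X Y Y⊆X with X zero in X₀ | Y zero in Y₀
... | true | true = trans (+-suc (count ((X minus Y) ∘ suc)) (count (Y ∘ suc)))
                          (cong suc (count-minus (X ∘ suc) (Y ∘ suc) (Y⊆X ∘ suc)))
... | true | false = cong suc (count-minus (X ∘ suc) (Y ∘ suc) (Y⊆X ∘ suc))
... | false | false = count-minus (X ∘ suc) (Y ∘ suc) (Y⊆X ∘ suc)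
... | false | true with trans (sym (Y⊆X zero Y₀)) X₀
...   | ()

count-positive : ∀ {n} (X : Fin n → Bool) u → X u ≡ true → 0 < count X
count-positive X zero Xu rewrite Xu = s≤s z≤n
count-positive X (suc u) Xu = ≤-trans (count-positive (X ∘ suc) u Xu) (m≤n+m _ (if X zero then 1 else 0))

count-minus-< : ∀ {n} (X Y : Fin n → Bool) → (∀ i → Y i ≡ true → X i ≡ true) →
                ∀ u → Y u ≡ true → count (X minus Y) < count X
count-minus-< X Y Y⊆X u Yu = subst (count (X minus Y) <_) (count-minus X Y Y⊆X)
  (m<m+n (count (X minus Y)) (count-positive Y u Yu))

count-step : ∀ {n} {m} (X Y : Fin n → Bool) → count X ≤ suc m →
             (∀ i → Y i ≡ true → X i ≡ true) → ∀ u → Y u ≡ true → count (X minus Y) ≤ m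
count-step X Y count≤m Y⊆X u Yu = ≤-pred (≤-trans (count-minus-< X Y Y⊆X u Yu) count≤m)

Matrix : ℕ → Set
Matrix k = Fin k → Fin k → Bool

minor : ∀ {k} → Matrix (suc k) → Fin (suc k) → Matrix k
minor M j a b = M (suc a) (punchIn j b)

det-expand : ∀ {k} (M : Matrix (suc k)) → det M ≡ ⨁ (λ j → M zero j ∧ det (minor M j))
det-expand M = sym (⨁-allFin (λ j → M zero j ∧ det (minor M j)))

det-cong : ∀ {k} {M N : Matrix k} → (∀ a b → M a b ≡ N a b) → det M ≡ det N
det-cong {zero} M≗N = refl
det-cong {suc k} {M} {N} M≗N = begin
  det M                                     ≡⟨ det-expand M ⟩
  ⨁ (λ j → M zero j ∧ det (minor M j))      ≡⟨ ⨁-cong term ⟩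
  ⨁ (λ j → N zero j ∧ det (minor N j))      ≡⟨ sym (det-expand N) ⟩
  det N                                     ∎
  where
  term : ∀ j → M zero j ∧ det (minor M j) ≡ N zero j ∧ det (minor N j)
  term j = cong₂ _∧_ (M≗N zero j) (det-cong (λ a b → M≗N (suc a) (punchIn j b)))

det-linear : ∀ {k} (M M₁ M₂ : Matrix k) (l : Fin k) →
             (∀ r c → c ≢ l → M₁ r c ≡ M r c) → (∀ r c → c ≢ l → M₂ r c ≡ M r c) →
             (∀ r → M r l ≡ M₁ r l xor M₂ r l) → det M ≡ det M₁ xor det M₂
det-linear {suc k} M M₁ M₂ l M₁≗M M₂≗M column-l = begin
  det M                             ≡⟨ det-expand M ⟩
  ⨁ (term M)                        ≡⟨ ⨁-cong split ⟩
  ⨁ (λ j → term M₁ j xor term M₂ j) ≡⟨ ⨁-xor (term M₁) (term M₂) ⟩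
  ⨁ (term M₁) xor ⨁ (term M₂)       ≡⟨ sym (cong₂ _xor_ (det-expand M₁) (det-expand M₂)) ⟩
  det M₁ xor det M₂                 ∎
  where
  term : Matrix (suc k) → Fin (suc k) → Bool
  term N j = N zero j ∧ det (minor N j)
  same-minor : ∀ (N : Matrix (suc k)) → (∀ r c → c ≢ l → N r c ≡ M r c) → det (minor N l) ≡ det (minor M l)
  same-minor N N≗M = det-cong (λ a b → N≗M (suc a) (punchIn l b) (punchInᵢ≢i l b))
  -- Deleting another column j leaves column l, where induction applies.
  minor-linear : ∀ j → j ≢ l → det (minor M j) ≡ det (minor M₁ j) xor det (minor M₂ j)
  minor-linear j j≢l = det-linear (minor M j) (minor M₁ j) (minor M₂ j) (punchOut j≢l)
    (λ r b b≢ → M₁≗M (suc r) (punchIn j b) (off b b≢))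
    (λ r b b≢ → M₂≗M (suc r) (punchIn j b) (off b b≢))
    (λ r → subst (λ c → M (suc r) c ≡ M₁ (suc r) c xor M₂ (suc r) c)
                 (sym (punchIn-punchOut j≢l)) (column-l (suc r)))
    where
    off : ∀ b → b ≢ punchOut j≢l → punchIn j b ≢ l
    off b b≢ e = b≢ (punchIn-injective j b _ (trans e (sym (punchIn-punchOut j≢l))))
  split : ∀ j → term M j ≡ term M₁ j xor term M₂ j
  split j with j ≟ l
  ... | yes refl = begin
    M zero j ∧ det (minor M j)
      ≡⟨ cong (_∧ det (minor M j)) (column-l zero) ⟩
    (M₁ zero j xor M₂ zero j) ∧ det (minor M j)
      ≡⟨ ∧-distribʳ-xor (det (minor M j)) (M₁ zero j) (M₂ zero j) ⟩
    (M₁ zero j ∧ det (minor M j)) xor (M₂ zero j ∧ det (minor M j))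
      ≡⟨ sym (cong₂ (λ d₁ d₂ → (M₁ zero j ∧ d₁) xor (M₂ zero j ∧ d₂))
                    (same-minor M₁ M₁≗M) (same-minor M₂ M₂≗M)) ⟩
    term M₁ j xor term M₂ j ∎
  ... | no j≢l = begin
    M zero j ∧ det (minor M j)
      ≡⟨ cong (M zero j ∧_) (minor-linear j j≢l) ⟩
    M zero j ∧ (det (minor M₁ j) xor det (minor M₂ j))
      ≡⟨ ∧-distribˡ-xor (M zero j) _ _ ⟩
    (M zero j ∧ det (minor M₁ j)) xor (M zero j ∧ det (minor M₂ j))
      ≡⟨ sym (cong₂ (λ a₁ a₂ → (a₁ ∧ det (minor M₁ j)) xor (a₂ ∧ det (minor M₂ j)))
                    (M₁≗M zero j j≢l) (M₂≗M zero j j≢l)) ⟩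
    term M₁ j xor term M₂ j ∎

Nonzero : ∀ {k} → (Fin k → Bool) → Set
Nonzero x = ∃ λ c → x c ≡ true

Injective : ∀ {k} → Matrix k → Set
Injective {k} M = ∀ (x : Fin k → Bool) → (∀ r → (M · x) r ≡ false) → ∀ c → x c ≡ false

Surjective : ∀ {k} → Matrix k → Set
Surjective {k} M = ∀ (b : Fin k → Bool) → Σ (Fin k → Bool) (λ x → ∀ r → (M · x) r ≡ b r)

Singular : ∀ {k} → Matrix k → Set
Singular {k} M = Σ (Fin k → Bool) (λ x → Nonzero x × (∀ r → (M · x) r ≡ false))

-- The determinant decides invertibility.  This dichotomy, established for
-- every matrix by `det-dichotomy`, is all the theorem needs to know about det.
Dichotomy : ∀ {k} → Matrix k → Set
Dichotomy M = (det M ≡ true × Injective M × Surjective M) ⊎ (det M ≡ false × Singular M)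

injective-nonsingular : ∀ {k} {M : Matrix k} → Injective M → Singular M → ⊥
injective-nonsingular inj (x , (c , xc) , Mx≡0) with trans (sym xc) (inj x Mx≡0 c)
... | ()

dichotomy-singular : ∀ {k} {M : Matrix k} → Dichotomy M → Singular M → det M ≡ false
dichotomy-singular (inj₁ (_ , inj , _)) sing = ⊥-elim (injective-nonsingular inj sing)
dichotomy-singular (inj₂ (det≡false , _)) _ = det≡false

dichotomy-injective : ∀ {k} {M : Matrix k} → Dichotomy M → det M ≡ true → Injective M
dichotomy-injective (inj₁ (_ , inj , _)) _ = inj
dichotomy-injective (inj₂ (det≡false , _)) det≡true with trans (sym det≡false) det≡true
... | ()

below : ∀ {k} → Matrix (suc k) → Fin k → Fin (suc k) → Bool
below M a = M (suc a)

·-below : ∀ {k} (M : Matrix (suc k)) (j : Fin (suc k)) (x : Fin (suc k) → Bool) a →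
          (below M · x) a ≡ (M (suc a) j ∧ x j) xor (minor M j · (x ∘ punchIn j)) a
·-below M j x a = ⨁-punchIn j (λ c → M (suc a) c ∧ x c)

restrict-kernel : ∀ {k} (M : Matrix (suc k)) (j : Fin (suc k)) (x : Fin (suc k) → Bool) →
                  x j ≡ false → Nonzero x → (∀ a → (below M · x) a ≡ false) → Singular (minor M j)
restrict-kernel M j x xj≡0 (e , xe) x-kills = x ∘ punchIn j , nonzero , kills
  where
  j≢e : j ≢ e
  j≢e refl with trans (sym xj≡0) xe
  ... | ()
  nonzero : Nonzero (x ∘ punchIn j)
  nonzero = punchOut j≢e , trans (cong x (punchIn-punchOut j≢e)) xe
  kills : ∀ a → (minor M j · (x ∘ punchIn j)) a ≡ false
  kills a = begin
    (minor M j · (x ∘ punchIn j)) a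
      ≡⟨ cong (_xor (minor M j · (x ∘ punchIn j)) a) (sym column-j) ⟩
    (M (suc a) j ∧ x j) xor (minor M j · (x ∘ punchIn j)) a   ≡⟨ sym (·-below M j x a) ⟩
    (below M · x) a                                           ≡⟨ x-kills a ⟩
    false                                                     ∎
    where
    column-j : M (suc a) j ∧ x j ≡ false
    column-j = trans (cong (M (suc a) j ∧_) xj≡0) (∧-zeroʳ _)

lift-kernel : ∀ {k} (M : Matrix (suc k)) (j : Fin (suc k)) → Singular (minor M j) →
              Σ (Fin (suc k) → Bool) (λ x → x j ≡ false × Nonzero x × (∀ a → (below M · x) a ≡ false))
lift-kernel {k} M j (x' , (e , x'e) , x'-kills) =
  x , insertAt-lookup x' j false , (punchIn j e , trans (insertAt-punchIn x' j false e) x'e) , kills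
  where
  x : Fin (suc k) → Bool
  x = insertAt x' j false
  kills : ∀ a → (below M · x) a ≡ false
  kills a = begin
    (below M · x) a
      ≡⟨ ·-below M j x a ⟩
    (M (suc a) j ∧ x j) xor (minor M j · (x ∘ punchIn j)) a
      ≡⟨ cong₂ (λ t y → (M (suc a) j ∧ t) xor y) (insertAt-lookup x' j false)
               (·-congʳ (minor M j) (insertAt-punchIn x' j false) a) ⟩
    (M (suc a) j ∧ false) xor (minor M j · x') a
      ≡⟨ cong₂ _xor_ (∧-zeroʳ (M (suc a) j)) (x'-kills a) ⟩
    false ∎

-- Adding column j to column l multiplies M on the right by an elementary
-- matrix; on vectors it is the invertible change of variables `shear j l`.
addColumn : ∀ {k} → Matrix k → Fin k → Fin k → Matrix k
addColumn M j l r c = M r c xor (M r j ∧ (c == l))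

shear : ∀ {k} → Fin k → Fin k → (Fin k → Bool) → Fin k → Bool
shear j l x c = x c xor ((c == j) ∧ x l)

·-addColumn : ∀ {k} (M : Matrix k) (j l : Fin k) (x : Fin k → Bool) r →
              (addColumn M j l · x) r ≡ (M · shear j l x) r
·-addColumn M j l x r = begin
  (addColumn M j l · x) r                               ≡⟨ ·-rank-one M (λ r → M r j) (_== l) x r ⟩
  (M · x) r xor (M r j ∧ ⨁ (λ c → (c == l) ∧ x c))      ≡⟨ cong (λ t → (M · x) r xor (M r j ∧ t)) (⨁-unitˡ l x) ⟩
  (M · x) r xor (M r j ∧ x l)                           ≡⟨ sym (·-add-unit M x j (x l) r) ⟩
  (M · shear j l x) r                                   ∎

shear-involutive : ∀ {k} (j l : Fin k) → l ≢ j → (x : Fin k → Bool) → ∀ c → shear j l (shear j l x) c ≡ x c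
shear-involutive j l l≢j x c = begin
  shear j l x c xor ((c == j) ∧ shear j l x l)
    ≡⟨ cong (λ t → shear j l x c xor ((c == j) ∧ (x l xor (t ∧ x l)))) (==-≢ l≢j) ⟩
  shear j l x c xor ((c == j) ∧ (x l xor false))
    ≡⟨ cong (λ t → shear j l x c xor ((c == j) ∧ t)) (xor-identityʳ (x l)) ⟩
  (x c xor ((c == j) ∧ x l)) xor ((c == j) ∧ x l)
    ≡⟨ xor-cancelʳ (x c) _ ⟩
  x c ∎

dichotomy-addColumn : ∀ {k} (M : Matrix k) (j l : Fin k) → l ≢ j →
                      det (addColumn M j l) ≡ det M → Dichotomy (addColumn M j l) → Dichotomy M
dichotomy-addColumn {k} M j l l≢j same-det (inj₁ (det≡true , inj , surj)) =
  inj₁ (trans (sym same-det) det≡true , injM , surjM)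
  where
  injM : Injective M
  injM x Mx≡0 c = begin
    x c                                                  ≡⟨ sym (shear-involutive j l l≢j x c) ⟩
    shear j l x' c                                       ≡⟨ cong₂ (λ a b → a xor ((c == j) ∧ b)) (x'≡0 c) (x'≡0 l) ⟩
    (c == j) ∧ false                                     ≡⟨ ∧-zeroʳ (c == j) ⟩
    false                                                ∎
    where
    x' : Fin k → Bool
    x' = shear j l x
    x'≡0 : ∀ c → x' c ≡ false
    x'≡0 = inj x' (λ r → trans (·-addColumn M j l x' r)
                               (trans (·-congʳ M (shear-involutive j l l≢j x) r) (Mx≡0 r)))
  surjM : Surjective M
  surjM b with surj b
  ... | x , solves = shear j l x , λ r → trans (sym (·-addColumn M j l x r)) (solves r)
dichotomy-addColumn M j l l≢j same-det (inj₂ (det≡false , x , (p , xp) , kills)) =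
  inj₂ (trans (sym same-det) det≡false , shear j l x , nonzero , λ r → trans (sym (·-addColumn M j l x r)) (kills r))
  where
  nonzero : Nonzero (shear j l x)
  nonzero with p ≟ j
  ... | no p≢j = p , trans (cong (λ t → x p xor (t ∧ x l)) (==-≢ p≢j)) (trans (xor-identityʳ (x p)) xp)
  ... | yes refl with x l in xl
  ...   | false = p , trans (cong (x p xor_) (∧-zeroʳ (p == p))) (trans (xor-identityʳ (x p)) xp)
  ...   | true = l , trans (cong (λ t → x l xor (t ∧ true)) (==-≢ l≢j)) (trans (xor-identityʳ (x l)) xl)

·-linear : ∀ {m k} (M : Fin m → Fin k → Bool) (x y : Fin k → Bool) s r →
           (M · (λ c → x c xor (s ∧ y c))) r ≡ (M · x) r xor (s ∧ (M · y) r)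
·-linear M x y s r = begin
  ⨁ (λ c → M r c ∧ (x c xor (s ∧ y c)))
    ≡⟨ ⨁-cong (λ c → ∧-distribˡ-xor (M r c) (x c) (s ∧ y c)) ⟩
  ⨁ (λ c → (M r c ∧ x c) xor (M r c ∧ (s ∧ y c)))
    ≡⟨ ⨁-xor (λ c → M r c ∧ x c) (λ c → M r c ∧ (s ∧ y c)) ⟩
  (M · x) r xor ⨁ (λ c → M r c ∧ (s ∧ y c))
    ≡⟨ cong ((M · x) r xor_) (⨁-cong (λ c → ∧-swap (M r c) s (y c))) ⟩
  (M · x) r xor ⨁ (λ c → s ∧ (M r c ∧ y c))
    ≡⟨ cong ((M · x) r xor_) (⨁-scaleˡ s (λ c → M r c ∧ y c)) ⟩
  (M · x) r xor (s ∧ (M · y) r) ∎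
  where
  ∧-swap : ∀ a b c → a ∧ (b ∧ c) ≡ b ∧ (a ∧ c)
  ∧-swap a b c = trans (sym (∧-assoc a b c)) (trans (cong (_∧ c) (∧-comm a b)) (∧-assoc b a c))

pair : ∀ {n} → Fin n → Fin n → Fin n → Bool
pair c d c' = (c' == c) xor (c' == d)

pair-left : ∀ {n} {u v : Fin n} → u ≢ v → pair u v u ≡ true
pair-left {u = u} u≢v = cong₂ _xor_ (==-refl u) (==-≢ u≢v)

pair-right : ∀ {n} {u v : Fin n} → u ≢ v → pair u v v ≡ true
pair-right {v = v} u≢v = cong₂ _xor_ (==-≢ (u≢v ∘ sym)) (==-refl v)

pair-orthogonal : ∀ {n} (ρ : Fin n → Bool) (c d : Fin n) → ρ c ≡ ρ d → ⨁ (λ c' → ρ c' ∧ pair c d c') ≡ false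
pair-orthogonal ρ c d ρc≡ρd = begin
  ⨁ (λ c' → ρ c' ∧ pair c d c')
    ≡⟨ ⨁-cong (λ c' → ∧-distribˡ-xor (ρ c') (c' == c) (c' == d)) ⟩
  ⨁ (λ c' → (ρ c' ∧ (c' == c)) xor (ρ c' ∧ (c' == d)))
    ≡⟨ ⨁-xor (λ c' → ρ c' ∧ (c' == c)) (λ c' → ρ c' ∧ (c' == d)) ⟩
  ⨁ (λ c' → ρ c' ∧ (c' == c)) xor ⨁ (λ c' → ρ c' ∧ (c' == d))
    ≡⟨ cong₂ _xor_ (⨁-unitʳ c ρ) (⨁-unitʳ d ρ) ⟩
  ρ c xor ρ d
    ≡⟨ cong (_xor ρ d) ρc≡ρd ⟩
  ρ d xor ρ d
    ≡⟨ xor-same (ρ d) ⟩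
  false ∎

-- First det is shown to
-- vanish on matrices with two equal columns, hence to be invariant under
-- column operations; then row 0 is cleared by column operations down to a
-- single entry, where Laplace expansion reduces everything to one minor.
module DichotomyStep {k : ℕ} (IH : (N : Matrix k) → Dichotomy N) where

  EqualColumns : Matrix (suc k) → Fin (suc k) → Fin (suc k) → Set
  EqualColumns M c d = c ≢ d × (∀ r → M r c ≡ M r d)

  -- A minor keeping both equal columns contains them, so is singular.
  det-minor-equal-columns : ∀ M c d i → EqualColumns M c d → i ≢ c → i ≢ d → det (minor M i) ≡ false
  det-minor-equal-columns M c d i (c≢d , same) i≢c i≢d =
    dichotomy-singular (IH (minor M i))
      (restrict-kernel M i (pair c d) (cong₂ _xor_ (==-≢ i≢c) (==-≢ i≢d))
                       (c , pair-left c≢d)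
                       (λ a → pair-orthogonal (M (suc a)) c d (same (suc a))))

  transport-kernel : ∀ M c d → EqualColumns M c d → Singular (minor M d) → Singular (minor M c)
  transport-kernel M c d (c≢d , same) sing-d with lift-kernel M d sing-d
  ... | x , xd≡0 , (e , xe) , x-kills = restrict-kernel M c y yc≡0 nonzero y-kills
    where
    -- y = x + x_c (e_c + e_d) vanishes at c and still kills the lower rows.
    y : Fin (suc k) → Bool
    y c' = x c' xor (x c ∧ pair c d c')
    yc≡0 : y c ≡ false
    yc≡0 = trans (cong (λ t → x c xor (x c ∧ t)) (pair-left c≢d))
                 (trans (cong (x c xor_) (∧-identityʳ (x c))) (xor-same (x c)))
    y-kills : ∀ a → (below M · y) a ≡ false
    y-kills a = begin
      (below M · y) a                                     ≡⟨ ·-linear (below M) x (pair c d) (x c) a ⟩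
      (below M · x) a xor (x c ∧ (below M · pair c d) a)  ≡⟨ cong₂ (λ p q → p xor (x c ∧ q)) (x-kills a)
                                                                   (pair-orthogonal (M (suc a)) c d (same (suc a))) ⟩
      false xor (x c ∧ false)                             ≡⟨ ∧-zeroʳ (x c) ⟩
      false                                               ∎
    nonzero : Nonzero y
    nonzero with x c in xc
    ... | true = d , cong₂ (λ p q → p xor (true ∧ q)) xd≡0 (pair-right c≢d)
    ... | false = e , trans (xor-identityʳ (x e)) xe

  minors-agree : ∀ M c d → EqualColumns M c d → det (minor M c) ≡ det (minor M d)
  minors-agree M c d eq@(c≢d , same) with IH (minor M c) | IH (minor M d)
  ... | inj₁ (det-c , _) | inj₁ (det-d , _) = trans det-c (sym det-d)
  ... | inj₂ (det-c , _) | inj₂ (det-d , _) = trans det-c (sym det-d)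
  ... | inj₁ (_ , inj-c , _) | inj₂ (_ , sing-d) =
    ⊥-elim (injective-nonsingular inj-c (transport-kernel M c d eq sing-d))
  ... | inj₂ (_ , sing-c) | inj₁ (_ , inj-d , _) =
    ⊥-elim (injective-nonsingular inj-d (transport-kernel M d c (c≢d ∘ sym , sym ∘ same) sing-c))

  det-equal-columns : ∀ M c d → EqualColumns M c d → det M ≡ false
  det-equal-columns M c d eq@(c≢d , same) = begin
    det M                  ≡⟨ det-expand M ⟩
    ⨁ term                 ≡⟨ ⨁-pair c d term c≢d other-terms ⟩
    term c xor term d      ≡⟨ cong (_xor term d) (cong₂ _∧_ (same zero) (minors-agree M c d eq)) ⟩
    term d xor term d      ≡⟨ xor-same (term d) ⟩
    false                  ∎
    where
    term : Fin (suc k) → Bool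
    term j = M zero j ∧ det (minor M j)
    other-terms : ∀ i → i ≢ c → i ≢ d → term i ≡ false
    other-terms i i≢c i≢d = trans (cong (M zero i ∧_) (det-minor-equal-columns M c d i eq i≢c i≢d))
                                  (∧-zeroʳ (M zero i))

  -- Hence column operations preserve det (linearity in column l).
  det-addColumn : ∀ M j l → l ≢ j → det (addColumn M j l) ≡ det M
  det-addColumn M j l l≢j = begin
    det (addColumn M j l)   ≡⟨ det-linear (addColumn M j l) M M' l (λ r c c≢l → sym (keeps M r c c≢l)) agree column-l ⟩
    det M xor det M'        ≡⟨ cong (det M xor_) (det-equal-columns M' l j (l≢j , equal)) ⟩
    det M xor false         ≡⟨ xor-identityʳ (det M) ⟩
    det M                   ∎
    where
    -- M' is M with column l replaced by column j.
    M' : Matrix (suc k)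
    M' r c = M r c xor ((M r c xor M r j) ∧ (c == l))
    keeps : ∀ (N : Matrix (suc k)) r c → c ≢ l → ∀ {b} → N r c xor (b ∧ (c == l)) ≡ N r c
    keeps N r c c≢l {b} = trans (cong (λ t → N r c xor (b ∧ t)) (==-≢ c≢l))
                                (trans (cong (N r c xor_) (∧-zeroʳ b)) (xor-identityʳ (N r c)))
    agree : ∀ r c → c ≢ l → M' r c ≡ addColumn M j l r c
    agree r c c≢l = trans (keeps M r c c≢l) (sym (keeps M r c c≢l))
    at-l : ∀ (N : Matrix (suc k)) r {b} → N r l xor (b ∧ (l == l)) ≡ N r l xor b
    at-l N r {b} = trans (cong (λ t → N r l xor (b ∧ t)) (==-refl l)) (cong (N r l xor_) (∧-identityʳ b))
    column-l : ∀ r → addColumn M j l r l ≡ M r l xor M' r l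
    column-l r = begin
      addColumn M j l r l                  ≡⟨ at-l M r ⟩
      M r l xor M r j                      ≡⟨ sym (cong (M r l xor_) (xor-cancelˡ (M r l) (M r j))) ⟩
      M r l xor (M r l xor (M r l xor M r j)) ≡⟨ sym (cong (M r l xor_) (at-l M r)) ⟩
      M r l xor M' r l                     ∎
    equal : ∀ r → M' r l ≡ M' r j
    equal r = begin
      M' r l                      ≡⟨ at-l M r ⟩
      M r l xor (M r l xor M r j) ≡⟨ xor-cancelˡ (M r l) (M r j) ⟩
      M r j                       ≡⟨ sym (keeps M r j (l≢j ∘ sym)) ⟩
      M' r j                      ∎

  -- Row 0 of M is the unit vector e_j: Laplace expansion collapses to one minor.
  UnitRow : Matrix (suc k) → Fin (suc k) → Set
  UnitRow M j = ∀ c → M zero c ≡ (c == j)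

  unit-row-det : ∀ M j → UnitRow M j → det M ≡ det (minor M j)
  unit-row-det M j row = trans (det-expand M)
    (trans (⨁-cong (λ c → cong (_∧ det (minor M c)) (row c))) (⨁-unitˡ j (λ c → det (minor M c))))

  unit-row-top : ∀ M j → UnitRow M j → ∀ x → (M · x) zero ≡ x j
  unit-row-top M j row x = trans (⨁-cong (λ c → cong (_∧ x c) (row c))) (⨁-unitˡ j x)

  dichotomy-unit-row : ∀ M j → UnitRow M j → Dichotomy M
  dichotomy-unit-row M j row with IH (minor M j)
  ... | inj₁ (det-N , inj-N , surj-N) = inj₁ (trans (unit-row-det M j row) det-N , injM , surjM)
    where
    injM : Injective M
    injM x Mx≡0 c with x c in xc
    ... | false = refl
    ... | true = ⊥-elim (injective-nonsingular inj-N
                   (restrict-kernel M j x (trans (sym (unit-row-top M j row x)) (Mx≡0 zero)) (c , xc) (Mx≡0 ∘ suc)))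
    surjM : Surjective M
    surjM b with surj-N (λ a → b (suc a) xor (M (suc a) j ∧ b zero))
    ... | x' , solves = x , solved
      where
      x : Fin (suc k) → Bool
      x = insertAt x' j (b zero)
      solved : ∀ r → (M · x) r ≡ b r
      solved zero = trans (unit-row-top M j row x) (insertAt-lookup x' j (b zero))
      solved (suc a) = begin
        (below M · x) a
          ≡⟨ ·-below M j x a ⟩
        (M (suc a) j ∧ x j) xor (minor M j · (x ∘ punchIn j)) a
          ≡⟨ cong₂ (λ t y → (M (suc a) j ∧ t) xor y) (insertAt-lookup x' j (b zero))
                   (trans (·-congʳ (minor M j) (insertAt-punchIn x' j (b zero)) a) (solves a)) ⟩
        (M (suc a) j ∧ b zero) xor (b (suc a) xor (M (suc a) j ∧ b zero))
          ≡⟨ cong ((M (suc a) j ∧ b zero) xor_) (xor-comm (b (suc a)) _) ⟩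
        (M (suc a) j ∧ b zero) xor ((M (suc a) j ∧ b zero) xor b (suc a))
          ≡⟨ xor-cancelˡ (M (suc a) j ∧ b zero) (b (suc a)) ⟩
        b (suc a) ∎
  ... | inj₂ (det-N , sing-N) with lift-kernel M j sing-N
  ...   | x , xj≡0 , nonzero , kills =
    inj₂ (trans (unit-row-det M j row) det-N , x , nonzero ,
          λ { zero → trans (unit-row-top M j row x) xj≡0 ; (suc a) → kills a })

  offPivot : Matrix (suc k) → Fin (suc k) → Fin (suc k) → Bool
  offPivot M j c = M zero c ∧ (c != j)

  unit-row-of-cleared : ∀ M j → M zero j ≡ true → (∀ c → offPivot M j c ≡ false) → UnitRow M j
  unit-row-of-cleared M j Mj cleared c with c ≟ j
  ... | yes refl = Mj
  ... | no c≢j = begin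
    M zero c                ≡⟨ sym (∧-identityʳ (M zero c)) ⟩
    M zero c ∧ true         ≡⟨ cong (M zero c ∧_) (sym (cong not (==-≢ c≢j))) ⟩
    offPivot M j c          ≡⟨ cleared c ⟩
    false                   ∎

  offPivot-addColumn : ∀ M j l → M zero j ≡ true → M zero l ≡ true → l ≢ j →
                       ∀ c → offPivot (addColumn M j l) j c ≡ (offPivot M j minus (_== l)) c
  offPivot-addColumn M j l Mj Ml l≢j c with c ≟ l
  ... | yes refl rewrite Mj | Ml | ==-≢ l≢j = refl
  ... | no c≢l rewrite ∧-zeroʳ (M zero j) | xor-identityʳ (M zero c) =
    sym (∧-identityʳ (M zero c ∧ (c != j)))

  -- Gaussian elimination on row 0, by induction on a bound m for the number
  -- of off-pivot entries; each column operation preserves det and the dichotomy.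
  dichotomy-pivot : ∀ m M j → M zero j ≡ true → count (offPivot M j) ≤ m → Dichotomy M
  dichotomy-pivot m M j Mj count≤m with search (offPivot M j)
  ... | inj₂ cleared = dichotomy-unit-row M j (unit-row-of-cleared M j Mj cleared)
  dichotomy-pivot zero M j Mj count≤0 | inj₁ (l , off-l) =
    ⊥-elim (<⇒≱ (count-positive (offPivot M j) l off-l) count≤0)
  dichotomy-pivot (suc m) M j Mj count≤m | inj₁ (l , off-l) =
    dichotomy-addColumn M j l l≢j (det-addColumn M j l l≢j) (dichotomy-pivot m (addColumn M j l) j still-pivot count′)
    where
    l≢j : l ≢ j
    l≢j = !=-≢ (∧-conicalʳ (M zero l) (l != j) off-l)
    Ml : M zero l ≡ true
    Ml = ∧-conicalˡ (M zero l) (l != j) off-l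
    still-pivot : addColumn M j l zero j ≡ true
    still-pivot = trans (cong (λ t → M zero j xor (M zero j ∧ t)) (==-≢ (l≢j ∘ sym)))
                  (trans (cong (M zero j xor_) (∧-zeroʳ (M zero j))) (trans (xor-identityʳ (M zero j)) Mj))
    count′ : count (offPivot (addColumn M j l) j) ≤ m
    count′ = subst (_≤ m) (sym (count-cong (offPivot-addColumn M j l Mj Ml l≢j)))
                   (count-step (offPivot M j) (_== l) count≤m (singleton⊆ (offPivot M j) off-l) l (==-refl l))

  dichotomy-zero-row : ∀ M → (∀ c → M zero c ≡ false) → Dichotomy M
  dichotomy-zero-row M zero-row = inj₂ (det≡false , kernel (IH (minor M zero)))
    where
    det≡false : det M ≡ false
    det≡false = trans (det-expand M) (⨁-zero _ (λ j → cong (_∧ det (minor M j)) (zero-row j)))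
    top : ∀ x → (M · x) zero ≡ false
    top x = ⨁-zero _ (λ c → cong (_∧ x c) (zero-row c))
    -- A kernel vector is e_0 + (a preimage of column 0), or a lifted kernel vector of the minor.
    kernel : Dichotomy (minor M zero) → Singular M
    kernel (inj₁ (_ , _ , surj)) with surj (λ a → M (suc a) zero)
    ... | x' , solves = insertAt x' zero true , (zero , refl) , kills
      where
      kills : ∀ r → (M · insertAt x' zero true) r ≡ false
      kills zero = top (insertAt x' zero true)
      kills (suc a) = trans (cong₂ _xor_ (∧-identityʳ (M (suc a) zero)) (solves a)) (xor-same (M (suc a) zero))
    kernel (inj₂ (_ , sing)) with lift-kernel M zero sing
    ... | x , _ , nonzero , kills = x , nonzero , λ { zero → top x ; (suc a) → kills a }

det-dichotomy : ∀ {k} (M : Matrix k) → Dichotomy M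
det-dichotomy {zero} M = inj₁ (refl , (λ _ _ ()) , λ b → (λ ()) , λ ())
det-dichotomy {suc k} M with search (M zero)
... | inj₂ zero-row = DichotomyStep.dichotomy-zero-row det-dichotomy M zero-row
... | inj₁ (j , Mj) = DichotomyStep.dichotomy-pivot det-dichotomy _ M j Mj ≤-refl

mix : ∀ {n} → (Fin n → Bool) → (Fin n → Bool) → (Fin n → Bool) → Fin n → Bool
mix X p q i = if X i then p i else q i

if-twice : ∀ (b : Bool) {p q : Bool} → (if b then (if b then p else q) else (if b then q else p)) ≡ p
if-twice false = refl
if-twice true = refl

if-compose : ∀ (b c : Bool) {p q : Bool} →
             (if c then (if b then q else p) else (if b then p else q)) ≡ (if b xor c then p else q)
if-compose false false = refl
if-compose false true = refl
if-compose true false = refl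
if-compose true true = refl

-- `Exchange A X B`: for every vector x, B sends mix X (A x) x to mix X x (A x),
-- i.e. B arises from A by exchanging input and output on the coordinates in X.
-- This is the principal pivot transform of A on X; it exists only if A[X] is
-- nonsingular (`exchange-nonsingular`), and it is unique (`exchange-unique`).
Exchange : ∀ {n} → Graph n → (Fin n → Bool) → Graph n → Set
Exchange {n} A X B = ∀ (x : Fin n → Bool) r → (B · mix X (A · x) x) r ≡ mix X x (A · x) r

PrincipalPivot : ∀ {n} → Graph n → (Fin n → Bool) → Graph n → Set
PrincipalPivot A X B = Exchange A X B × Exchange B X A

module _ {n : ℕ} where

  exchange-empty : ∀ {A : Graph n} → Exchange A (λ _ → false) A
  exchange-empty x r = refl

  exchange-cong-subset : ∀ {A B : Graph n} {X Y : Fin n → Bool} → (∀ i → X i ≡ Y i) → Exchange A X B → Exchange A Y B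
  exchange-cong-subset {A} {B} {X} {Y} X≗Y ex x r = begin
    (B · mix Y (A · x) x) r  ≡⟨ ·-congʳ B (λ i → cong (λ b → if b then (A · x) i else x i) (sym (X≗Y i))) r ⟩
    (B · mix X (A · x) x) r  ≡⟨ ex x r ⟩
    mix X x (A · x) r        ≡⟨ cong (λ b → if b then x r else (A · x) r) (X≗Y r) ⟩
    mix Y x (A · x) r        ∎

  exchange-cong-target : ∀ {A B B' : Graph n} {X : Fin n → Bool} → B ≈G B' → Exchange A X B → Exchange A X B'
  exchange-cong-target {A} {X = X} B≈B' ex x r = trans (sym (·-congˡ (mix X (A · x) x) B≈B' r)) (ex x r)

  exchange-compose : ∀ {A B C : Graph n} {X Y : Fin n → Bool} →
                     Exchange A X B → Exchange B Y C → Exchange A (λ i → X i xor Y i) C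
  exchange-compose {A} {B} {C} {X} {Y} AB BC x r = begin
    (C · mix XY (A · x) x) r  ≡⟨ ·-congʳ C (λ i → sym (via-B i)) r ⟩
    (C · mix Y (B · w) w) r   ≡⟨ BC w r ⟩
    mix Y w (B · w) r         ≡⟨ via-B' ⟩
    mix XY x (A · x) r        ∎
    where
    XY w : Fin n → Bool
    XY i = X i xor Y i
    w = mix X (A · x) x
    via-B : ∀ i → mix Y (B · w) w i ≡ mix XY (A · x) x i
    via-B i = trans (cong (λ t → if Y i then t else w i) (AB x i)) (if-compose (X i) (Y i))
    via-B' : mix Y w (B · w) r ≡ mix XY x (A · x) r
    via-B' = trans (cong (λ t → if Y r then w r else t) (AB x r)) (if-compose (X r) (Y r))

  exchange-unique : ∀ {A B B' : Graph n} {X : Fin n → Bool} →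
                    Exchange A X B → Exchange B X A → Exchange A X B' → B ≈G B'
  exchange-unique {A} {B} {B'} {X} AB BA AB' a b = begin
    B a b                          ≡⟨ sym (⨁-unitʳ b (B a)) ⟩
    (B · (_== b)) a                ≡⟨ same-action (_== b) a ⟩
    (B' · (_== b)) a               ≡⟨ ⨁-unitʳ b (B' a) ⟩
    B' a b                         ∎
    where
    -- Every w is mix X (A x) x for x = mix X (B w) w, so B and B' act alike.
    same-action : ∀ w r → (B · w) r ≡ (B' · w) r
    same-action w r = begin
      (B · w) r                ≡⟨ sym (rebuild' r) ⟩
      mix X x (A · x) r        ≡⟨ sym (AB' x r) ⟩
      (B' · mix X (A · x) x) r ≡⟨ ·-congʳ B' rebuild r ⟩
      (B' · w) r               ∎
      where
      x : Fin n → Bool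
      x = mix X (B · w) w
      rebuild : ∀ i → mix X (A · x) x i ≡ w i
      rebuild i = trans (cong (λ t → if X i then t else x i) (BA w i)) (if-twice (X i))
      rebuild' : ∀ r → mix X x (A · x) r ≡ (B · w) r
      rebuild' r = trans (cong (λ t → if X r then x r else t) (BA w r)) (if-twice (X r))

ppt-empty : ∀ {n} {A : Graph n} → PrincipalPivot A (λ _ → false) A
ppt-empty = exchange-empty , exchange-empty

ppt-cong-subset : ∀ {n} {A B : Graph n} {X Y : Fin n → Bool} → (∀ i → X i ≡ Y i) → PrincipalPivot A X B → PrincipalPivot A Y B
ppt-cong-subset X≗Y (AB , BA) = exchange-cong-subset X≗Y AB , exchange-cong-subset X≗Y BA

ppt-compose : ∀ {n} {A B C : Graph n} {X Y : Fin n → Bool} →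
              PrincipalPivot A X B → PrincipalPivot B Y C → PrincipalPivot A (λ i → X i xor Y i) C
ppt-compose {X = X} {Y} (AB , BA) (BC , CB) =
  exchange-compose AB BC , exchange-cong-subset (λ i → xor-comm (Y i) (X i)) (exchange-compose CB BA)

mix-unit : ∀ {n} (p q : Fin n → Bool) (u i : Fin n) →
           mix (_== u) p q i ≡ q i xor ((i == u) ∧ (p u xor q u))
mix-unit p q u i with i ≟ u
... | yes refl = sym (xor-cancel-middle (p i) (q i))
... | no _ = sym (xor-identityʳ (q i))

mix-pair : ∀ {n} (p q : Fin n → Bool) {u v : Fin n} → u ≢ v → ∀ i →
           mix (pair u v) p q i ≡ (q i xor ((i == u) ∧ (p u xor q u))) xor ((i == v) ∧ (p v xor q v))
mix-pair p q {u} {v} u≢v i with i ≟ u | i ≟ v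
... | yes refl | yes refl = ⊥-elim (u≢v refl)
... | yes refl | no _ = sym (trans (xor-identityʳ _) (xor-cancel-middle (p i) (q i)))
... | no _ | yes refl = sym (trans (cong (_xor (p i xor q i)) (xor-identityʳ (q i))) (xor-cancel-middle (p i) (q i)))
... | no _ | no _ = sym (trans (xor-identityʳ _) (xor-identityʳ (q i)))

-- Row u of G plus the unit vector e_u.  For a vertex with a loop this is its
-- open neighbourhood; for a loopless vertex it is its closed neighbourhood N'.
closedRow : ∀ {n} → Graph n → Fin n → Fin n → Bool
closedRow G u c = G u c xor (c == u)

closedRow-dot : ∀ {n} (G : Graph n) (u : Fin n) (w : Fin n → Bool) →
                ⨁ (λ c → closedRow G u c ∧ w c) ≡ (G · w) u xor w u
closedRow-dot G u w = begin
  ⨁ (λ c → (G u c xor (c == u)) ∧ w c)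
    ≡⟨ ⨁-cong (λ c → ∧-distribʳ-xor (w c) (G u c) (c == u)) ⟩
  ⨁ (λ c → (G u c ∧ w c) xor ((c == u) ∧ w c))
    ≡⟨ ⨁-xor (λ c → G u c ∧ w c) (λ c → (c == u) ∧ w c) ⟩
  (G · w) u xor ⨁ (λ c → (c == u) ∧ w c)
    ≡⟨ cong ((G · w) u xor_) (⨁-unitˡ u w) ⟩
  (G · w) u xor w u ∎

-- The coordinate identity behind both exchange lemmas: adding the column
-- g·s and then (g + e)·s to y leaves y + e·s.
xor-absorb : ∀ y g e s → (y xor (g ∧ s)) xor ((g xor e) ∧ s) ≡ y xor (e ∧ s)
xor-absorb y g e s = begin
  (y xor (g ∧ s)) xor ((g xor e) ∧ s)        ≡⟨ cong ((y xor (g ∧ s)) xor_) (∧-distribʳ-xor s g e) ⟩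
  (y xor (g ∧ s)) xor ((g ∧ s) xor (e ∧ s))  ≡⟨ xor-assoc y (g ∧ s) _ ⟩
  y xor ((g ∧ s) xor ((g ∧ s) xor (e ∧ s)))  ≡⟨ cong (y xor_) (xor-cancelˡ (g ∧ s) (e ∧ s)) ⟩
  y xor (e ∧ s)                              ∎

localComp-normal : ∀ {n} (G : Graph n) u x y →
                   localComp G u x y ≡ G x y xor (((x != u) ∧ G u x) ∧ ((y != u) ∧ G u y))
localComp-normal G u x y with x ≟ y
... | yes refl = cong (G x x xor_) (sym (∧-idem ((x != u) ∧ G u x)))
... | no _ = cong (G x y xor_) (∧-interchange (x != u) (y != u) (G u x) (G u y))
  where
  ∧-interchange : ∀ a b c d → a ∧ (b ∧ (c ∧ d)) ≡ (a ∧ c) ∧ (b ∧ d)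
  ∧-interchange false b c d = refl
  ∧-interchange true false c d = sym (∧-zeroʳ c)
  ∧-interchange true true c d = refl

looped-row : ∀ {n} (G : Graph n) u → G u u ≡ true → ∀ c → (c != u) ∧ G u c ≡ closedRow G u c
looped-row G u Guu c with c ≟ u
... | yes refl = sym (cong (_xor true) Guu)
... | no _ = sym (xor-identityʳ (G u c))

localComp-rank-one : ∀ {n} (G : Graph n) u → G u u ≡ true →
                     ∀ x y → localComp G u x y ≡ G x y xor (closedRow G u x ∧ closedRow G u y)
localComp-rank-one G u Guu x y =
  trans (localComp-normal G u x y) (cong₂ (λ a b → G x y xor (a ∧ b)) (looped-row G u Guu x) (looped-row G u Guu y))

localComp-symmetric : ∀ {n} (G : Graph n) u → Symmetric G → Symmetric (localComp G u)
localComp-symmetric G u G-sym x y = begin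
  localComp G u x y                                                 ≡⟨ localComp-normal G u x y ⟩
  G x y xor (((x != u) ∧ G u x) ∧ ((y != u) ∧ G u y))              ≡⟨ cong₂ _xor_ (G-sym x y) (∧-comm ((x != u) ∧ G u x) _) ⟩
  G y x xor (((y != u) ∧ G u y) ∧ ((x != u) ∧ G u x))              ≡⟨ sym (localComp-normal G u y x) ⟩
  localComp G u y x                                                 ∎

localComp-row : ∀ {n} (G : Graph n) u x → localComp G u u x ≡ G u x
localComp-row G u x = begin
  localComp G u u x                                         ≡⟨ localComp-normal G u u x ⟩
  G u x xor (((u != u) ∧ G u u) ∧ ((x != u) ∧ G u x))       ≡⟨ cong (λ t → G u x xor ((not t ∧ G u u) ∧ ((x != u) ∧ G u x))) (==-refl u) ⟩
  G u x xor false                                           ≡⟨ xor-identityʳ (G u x) ⟩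
  G u x                                                     ∎

localComp-involutive : ∀ {n} (G : Graph n) u → localComp (localComp G u) u ≈G G
localComp-involutive G u x y = begin
  localComp (localComp G u) u x y
    ≡⟨ localComp-normal (localComp G u) u x y ⟩
  localComp G u x y xor (((x != u) ∧ localComp G u u x) ∧ ((y != u) ∧ localComp G u u y))
    ≡⟨ cong₂ (λ p q → localComp G u x y xor (((x != u) ∧ p) ∧ ((y != u) ∧ q))) (localComp-row G u x) (localComp-row G u y) ⟩
  localComp G u x y xor (((x != u) ∧ G u x) ∧ ((y != u) ∧ G u y))
    ≡⟨ cong (_xor (((x != u) ∧ G u x) ∧ ((y != u) ∧ G u y))) (localComp-normal G u x y) ⟩
  (G x y xor (((x != u) ∧ G u x) ∧ ((y != u) ∧ G u y))) xor (((x != u) ∧ G u x) ∧ ((y != u) ∧ G u y))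
    ≡⟨ xor-cancelʳ (G x y) _ ⟩
  G x y ∎

-- Local complementation at a looped vertex u is the principal pivot transform
-- on {u}: for y = G z and w = z + s e_u (s = y_u + z_u) one finds
-- (G*u) w = G w + s β = y + s e_u, using G_uu = 1 and the symmetry of G.
localComp-exchange : ∀ {n} (G : Graph n) u → Symmetric G → G u u ≡ true → Exchange G (_== u) (localComp G u)
localComp-exchange {n} G u G-sym Guu z r = begin
  (localComp G u · w) r                  ≡⟨ ·-congˡ w (localComp-rank-one G u Guu) r ⟩
  ((λ a b → G a b xor (β a ∧ β b)) · w) r ≡⟨ ·-rank-one G β β w r ⟩
  (G · w) r xor (β r ∧ ⨁ (λ c → β c ∧ w c)) ≡⟨ cong₂ (λ p q → p xor (β r ∧ q)) (G·w r) β·w ⟩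
  (y r xor (G r u ∧ s)) xor (β r ∧ s)    ≡⟨ cong (λ g → (y r xor (G r u ∧ s)) xor ((g xor (r == u)) ∧ s)) (G-sym u r) ⟩
  (y r xor (G r u ∧ s)) xor ((G r u xor (r == u)) ∧ s) ≡⟨ xor-absorb (y r) (G r u) (r == u) s ⟩
  y r xor ((r == u) ∧ s)                 ≡⟨ cong (λ t → y r xor ((r == u) ∧ t)) (xor-comm (y u) (z u)) ⟩
  y r xor ((r == u) ∧ (z u xor y u))     ≡⟨ sym (mix-unit z y u r) ⟩
  mix (_== u) z y r                      ∎
  where
  y w β : Fin n → Bool
  y = G · z
  w = mix (_== u) y z
  β = closedRow G u
  s : Bool
  s = y u xor z u
  G·w : ∀ r → (G · w) r ≡ y r xor (G r u ∧ s)
  G·w r = trans (·-congʳ G (mix-unit y z u) r) (·-add-unit G z u s r)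
  β·w : ⨁ (λ c → β c ∧ w c) ≡ s
  β·w = begin
    ⨁ (λ c → β c ∧ w c)             ≡⟨ closedRow-dot G u w ⟩
    (G · w) u xor w u               ≡⟨ cong₂ _xor_ (G·w u) (cong (λ b → if b then y u else z u) (==-refl u)) ⟩
    (y u xor (G u u ∧ s)) xor y u   ≡⟨ cong (λ g → (y u xor (g ∧ s)) xor y u) Guu ⟩
    (y u xor s) xor y u             ≡⟨ cong (_xor y u) (xor-comm (y u) s) ⟩
    (s xor y u) xor y u             ≡⟨ xor-cancelʳ s (y u) ⟩
    s                               ∎

localComp-ppt : ∀ {n} (G : Graph n) u → Symmetric G → G u u ≡ true → PrincipalPivot G (_== u) (localComp G u)
localComp-ppt G u G-sym Guu =
  localComp-exchange G u G-sym Guu ,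
  exchange-cong-target (localComp-involutive G u)
    (localComp-exchange (localComp G u) u (localComp-symmetric G u G-sym) (trans (localComp-row G u u) Guu))

pivot-normal : ∀ {n} (G : Graph n) u v x y →
               pivot G u v x y ≡ G x y xor ((N' G u x ∧ N' G v y) xor (N' G v x ∧ N' G u y))
pivot-normal G u v x y with N' G u x | N' G v x | N' G u y | N' G v y
... | false | false | false | false = refl
... | false | false | false | true  = refl
... | false | false | true  | false = refl
... | false | false | true  | true  = refl
... | false | true  | false | false = refl
... | false | true  | false | true  = refl
... | false | true  | true  | false = refl
... | false | true  | true  | true  = refl
... | true  | false | false | false = refl
... | true  | false | false | true  = refl
... | true  | false | true  | false = refl
... | true  | false | true  | true  = refl
... | true  | true  | false | false = refl
... | true  | true  | false | true  = refl
... | true  | true  | true  | false = refl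
... | true  | true  | true  | true  = refl

pivot-loops : ∀ {n} (G : Graph n) u v x → pivot G u v x x ≡ G x x
pivot-loops G u v x = begin
  pivot G u v x x                                                ≡⟨ pivot-normal G u v x x ⟩
  G x x xor ((N' G u x ∧ N' G v x) xor (N' G v x ∧ N' G u x))    ≡⟨ cong (λ t → G x x xor ((N' G u x ∧ N' G v x) xor t)) (∧-comm (N' G v x) _) ⟩
  G x x xor ((N' G u x ∧ N' G v x) xor (N' G u x ∧ N' G v x))    ≡⟨ cong (G x x xor_) (xor-same (N' G u x ∧ N' G v x)) ⟩
  G x x xor false                                                ≡⟨ xor-identityʳ (G x x) ⟩
  G x x                                                          ∎

pivot-symmetric : ∀ {n} (G : Graph n) u v → Symmetric G → Symmetric (pivot G u v)
pivot-symmetric G u v G-sym x y = begin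
  pivot G u v x y                                                 ≡⟨ pivot-normal G u v x y ⟩
  G x y xor ((N' G u x ∧ N' G v y) xor (N' G v x ∧ N' G u y))     ≡⟨ cong₂ _xor_ (G-sym x y) (xor-comm (N' G u x ∧ N' G v y) (N' G v x ∧ N' G u y)) ⟩
  G y x xor ((N' G v x ∧ N' G u y) xor (N' G u x ∧ N' G v y))     ≡⟨ cong (G y x xor_) (cong₂ _xor_ (∧-comm (N' G v x) _) (∧-comm (N' G u x) _)) ⟩
  G y x xor ((N' G u y ∧ N' G v x) xor (N' G v y ∧ N' G u x))     ≡⟨ sym (pivot-normal G u v y x) ⟩
  pivot G u v y x                                                 ∎

N'-loopless : ∀ {n} (G : Graph n) u → G u u ≡ false → ∀ x → N' G u x ≡ closedRow G u x
N'-loopless G u Guu x with x ≟ u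
... | yes refl = sym (cong (_xor true) Guu)
... | no _ = sym (xor-identityʳ (G u x))

pivot-rank-two : ∀ {n} (G : Graph n) u v → G u u ≡ false → G v v ≡ false → ∀ x y →
                 pivot G u v x y ≡ (G x y xor (closedRow G u x ∧ closedRow G v y)) xor (closedRow G v x ∧ closedRow G u y)
pivot-rank-two {n} G u v Guu Gvv x y = begin
  pivot G u v x y
    ≡⟨ pivot-normal G u v x y ⟩
  G x y xor ((N' G u x ∧ N' G v y) xor (N' G v x ∧ N' G u y))
    ≡⟨ cong (G x y xor_) (cong₂ _xor_ (cong₂ _∧_ (N'-loopless G u Guu x) (N'-loopless G v Gvv y))
                                      (cong₂ _∧_ (N'-loopless G v Gvv x) (N'-loopless G u Guu y))) ⟩
  G x y xor ((a x ∧ b y) xor (b x ∧ a y))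
    ≡⟨ sym (xor-assoc (G x y) _ _) ⟩
  (G x y xor (a x ∧ b y)) xor (b x ∧ a y) ∎
  where
  a b : Fin n → Bool
  a = closedRow G u
  b = closedRow G v

module Pivoting {n : ℕ} (G : Graph n) (u v : Fin n) (G-sym : Symmetric G) (defined : PivotDefined G u v) where

  Guv : G u v ≡ true
  Guv = proj₁ defined
  u≢v : u ≢ v
  u≢v = proj₁ (proj₂ defined)
  Guu : G u u ≡ false
  Guu = proj₁ (proj₂ (proj₂ defined))
  Gvv : G v v ≡ false
  Gvv = proj₂ (proj₂ (proj₂ defined))

  a b : Fin n → Bool
  a = closedRow G u
  b = closedRow G v

  au : a u ≡ true
  au = cong₂ _xor_ Guu (==-refl u)
  bu : b u ≡ true
  bu = cong₂ _xor_ (trans (G-sym v u) Guv) (==-≢ u≢v)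
  av : a v ≡ true
  av = cong₂ _xor_ Guv (==-≢ (u≢v ∘ sym))
  bv : b v ≡ true
  bv = cong₂ _xor_ Gvv (==-refl v)

  rank-two : ∀ x y → pivot G u v x y ≡ (G x y xor (a x ∧ b y)) xor (b x ∧ a y)
  rank-two = pivot-rank-two G u v Guu Gvv

  B : Graph n
  B = pivot G u v

  row : ∀ w → a w ≡ true → b w ≡ true → ∀ x → B w x ≡ (G w x xor b x) xor a x
  row w aw bw x = trans (rank-two w x) (cong₂ (λ p q → (G w x xor (p ∧ b x)) xor (q ∧ a x)) aw bw)

  a′ : ∀ x → closedRow B u x ≡ b x
  a′ x = begin
    B u x xor (x == u)                           ≡⟨ cong (_xor (x == u)) (row u au bu x) ⟩
    ((G u x xor b x) xor a x) xor (x == u)        ≡⟨ cong (_xor (x == u)) (xor-swap-last (G u x) (b x) (a x)) ⟩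
    ((G u x xor a x) xor b x) xor (x == u)        ≡⟨ xor-swap-last (G u x xor a x) (b x) (x == u) ⟩
    ((G u x xor a x) xor (x == u)) xor b x        ≡⟨ cong (_xor b x) (trans (xor-assoc (G u x) (a x) (x == u)) (cong (G u x xor_) (xor-cancelʳ (G u x) (x == u)))) ⟩
    (G u x xor G u x) xor b x                     ≡⟨ cong (_xor b x) (xor-same (G u x)) ⟩
    b x                                           ∎

  b′ : ∀ x → closedRow B v x ≡ a x
  b′ x = begin
    B v x xor (x == v)                           ≡⟨ cong (_xor (x == v)) (row v av bv x) ⟩
    ((G v x xor b x) xor a x) xor (x == v)        ≡⟨ xor-swap-last (G v x xor b x) (a x) (x == v) ⟩
    ((G v x xor b x) xor (x == v)) xor a x        ≡⟨ cong (_xor a x) (trans (xor-assoc (G v x) (b x) (x == v)) (cong (G v x xor_) (xor-cancelʳ (G v x) (x == v)))) ⟩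
    (G v x xor G v x) xor a x                     ≡⟨ cong (_xor a x) (xor-same (G v x)) ⟩
    a x                                           ∎

  defined′ : PivotDefined B u v
  defined′ = Buv , u≢v , trans (pivot-loops G u v u) Guu , trans (pivot-loops G u v v) Gvv
    where
    Buv : B u v ≡ true
    Buv = trans (row u au bu v) (cong₂ _xor_ (cong₂ _xor_ Guv bv) av)

  involutive : pivot B u v ≈G G
  involutive x y = begin
    pivot B u v x y
      ≡⟨ pivot-rank-two B u v (proj₁ (proj₂ (proj₂ defined′))) (proj₂ (proj₂ (proj₂ defined′))) x y ⟩
    (B x y xor (closedRow B u x ∧ closedRow B v y)) xor (closedRow B v x ∧ closedRow B u y)
      ≡⟨ cong₂ (λ p q → (B x y xor p) xor q) (cong₂ _∧_ (a′ x) (b′ y)) (cong₂ _∧_ (b′ x) (a′ y)) ⟩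
    (B x y xor (b x ∧ a y)) xor (a x ∧ b y)
      ≡⟨ cong (λ t → (t xor (b x ∧ a y)) xor (a x ∧ b y)) (rank-two x y) ⟩
    (((G x y xor (a x ∧ b y)) xor (b x ∧ a y)) xor (b x ∧ a y)) xor (a x ∧ b y)
      ≡⟨ cong (_xor (a x ∧ b y)) (xor-cancelʳ (G x y xor (a x ∧ b y)) (b x ∧ a y)) ⟩
    (G x y xor (a x ∧ b y)) xor (a x ∧ b y)
      ≡⟨ xor-cancelʳ (G x y) (a x ∧ b y) ⟩
    G x y ∎

  module ForVector (z : Fin n → Bool) where

    y w : Fin n → Bool
    y = G · z
    w = mix (pair u v) y z

    s t : Bool
    s = y u xor z u
    t = y v xor z v

    G·w : ∀ r → (G · w) r ≡ (y r xor (G r u ∧ s)) xor (G r v ∧ t)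
    G·w r = begin
      (G · w) r
        ≡⟨ ·-congʳ G (mix-pair y z u≢v) r ⟩
      (G · (λ c → (z c xor ((c == u) ∧ s)) xor ((c == v) ∧ t))) r
        ≡⟨ ·-add-unit G (λ c → z c xor ((c == u) ∧ s)) v t r ⟩
      (G · (λ c → z c xor ((c == u) ∧ s))) r xor (G r v ∧ t)
        ≡⟨ cong (_xor (G r v ∧ t)) (·-add-unit G z u s r) ⟩
      (y r xor (G r u ∧ s)) xor (G r v ∧ t) ∎

    wu : w u ≡ y u
    wu = cong (λ p → if p then y u else z u) (pair-left u≢v)
    wv : w v ≡ y v
    wv = cong (λ p → if p then y v else z v) (pair-right u≢v)

    b·w : ⨁ (λ c → b c ∧ w c) ≡ s
    b·w = begin
      ⨁ (λ c → b c ∧ w c)                               ≡⟨ closedRow-dot G v w ⟩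
      (G · w) v xor w v                                 ≡⟨ cong₂ _xor_ (G·w v) wv ⟩
      ((y v xor (G v u ∧ s)) xor (G v v ∧ t)) xor y v   ≡⟨ cong₂ (λ p q → ((y v xor (p ∧ s)) xor (q ∧ t)) xor y v) (trans (G-sym v u) Guv) Gvv ⟩
      ((y v xor s) xor false) xor y v                   ≡⟨ cong (_xor y v) (trans (xor-identityʳ (y v xor s)) (xor-comm (y v) s)) ⟩
      (s xor y v) xor y v                               ≡⟨ xor-cancelʳ s (y v) ⟩
      s                                                 ∎

    a·w : ⨁ (λ c → a c ∧ w c) ≡ t
    a·w = begin
      ⨁ (λ c → a c ∧ w c)                               ≡⟨ closedRow-dot G u w ⟩
      (G · w) u xor w u                                 ≡⟨ cong₂ _xor_ (G·w u) wu ⟩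
      ((y u xor (G u u ∧ s)) xor (G u v ∧ t)) xor y u   ≡⟨ cong₂ (λ p q → ((y u xor (p ∧ s)) xor (q ∧ t)) xor y u) Guu Guv ⟩
      ((y u xor false) xor t) xor y u                   ≡⟨ cong (λ p → (p xor t) xor y u) (xor-identityʳ (y u)) ⟩
      (y u xor t) xor y u                               ≡⟨ cong (_xor y u) (xor-comm (y u) t) ⟩
      (t xor y u) xor y u                               ≡⟨ xor-cancelʳ t (y u) ⟩
      t                                                 ∎

    B·w : ∀ r → (B · w) r ≡ ((G · w) r xor (a r ∧ s)) xor (b r ∧ t)
    B·w r = begin
      (B · w) r
        ≡⟨ ·-congˡ w rank-two r ⟩
      ((λ x y → (G x y xor (a x ∧ b y)) xor (b x ∧ a y)) · w) r
        ≡⟨ ·-rank-one (λ x y → G x y xor (a x ∧ b y)) b a w r ⟩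
      ((λ x y → G x y xor (a x ∧ b y)) · w) r xor (b r ∧ ⨁ (λ c → a c ∧ w c))
        ≡⟨ cong (_xor (b r ∧ ⨁ (λ c → a c ∧ w c))) (·-rank-one G a b w r) ⟩
      ((G · w) r xor (a r ∧ ⨁ (λ c → b c ∧ w c))) xor (b r ∧ ⨁ (λ c → a c ∧ w c))
        ≡⟨ cong₂ (λ p q → ((G · w) r xor (a r ∧ p)) xor (b r ∧ q)) b·w a·w ⟩
      ((G · w) r xor (a r ∧ s)) xor (b r ∧ t) ∎

  -- G[uv] is the principal pivot transform of G on {u, v}: the terms s a + t b
  -- cancel the columns G e_u s + G e_v t except at u and v (symmetry of G).
  exchange : Exchange G (pair u v) B
  exchange z r = begin
    (B · w) r
      ≡⟨ B·w r ⟩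
    ((G · w) r xor (a r ∧ s)) xor (b r ∧ t)
      ≡⟨ cong (λ p → (p xor (a r ∧ s)) xor (b r ∧ t)) (G·w r) ⟩
    (((y r xor (G r u ∧ s)) xor (G r v ∧ t)) xor (a r ∧ s)) xor (b r ∧ t)
      ≡⟨ cong₂ (λ p q → (((y r xor (G r u ∧ s)) xor (G r v ∧ t)) xor ((p xor (r == u)) ∧ s)) xor ((q xor (r == v)) ∧ t))
               (G-sym u r) (G-sym v r) ⟩
    (((y r xor (G r u ∧ s)) xor (G r v ∧ t)) xor ((G r u xor (r == u)) ∧ s)) xor ((G r v xor (r == v)) ∧ t)
      ≡⟨ cong (_xor ((G r v xor (r == v)) ∧ t)) (xor-swap-last (y r xor (G r u ∧ s)) _ _) ⟩
    (((y r xor (G r u ∧ s)) xor ((G r u xor (r == u)) ∧ s)) xor (G r v ∧ t)) xor ((G r v xor (r == v)) ∧ t)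
      ≡⟨ cong (λ p → (p xor (G r v ∧ t)) xor ((G r v xor (r == v)) ∧ t)) (xor-absorb (y r) (G r u) (r == u) s) ⟩
    ((y r xor ((r == u) ∧ s)) xor (G r v ∧ t)) xor ((G r v xor (r == v)) ∧ t)
      ≡⟨ xor-absorb (y r xor ((r == u) ∧ s)) (G r v) (r == v) t ⟩
    (y r xor ((r == u) ∧ s)) xor ((r == v) ∧ t)
      ≡⟨ cong₂ (λ p q → (y r xor ((r == u) ∧ p)) xor ((r == v) ∧ q)) (xor-comm (y u) (z u)) (xor-comm (y v) (z v)) ⟩
    (y r xor ((r == u) ∧ (z u xor y u))) xor ((r == v) ∧ (z v xor y v))
      ≡⟨ sym (mix-pair z y u≢v r) ⟩
    mix (pair u v) z y r ∎
    where open ForVector z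

pivot-ppt : ∀ {n} (G : Graph n) u v → Symmetric G → PivotDefined G u v → PrincipalPivot G (pair u v) (pivot G u v)
pivot-ppt G u v G-sym defined =
  Pivoting.exchange G u v G-sym defined ,
  exchange-cong-target (Pivoting.involutive G u v G-sym defined)
    (Pivoting.exchange (pivot G u v) u v (pivot-symmetric G u v G-sym) (Pivoting.defined′ G u v G-sym defined))

support : ∀ {n} → List (Op n) → Fin n → Bool
support φ i = Vec.lookup (sup φ) i

lookup-singleton : ∀ {n} (u i : Fin n) → Vec.lookup ⁅ u ⁆ i ≡ (i == u)
lookup-singleton zero zero = refl
lookup-singleton zero (suc i) = Vec.lookup-replicate i false
lookup-singleton (suc u) zero = refl
lookup-singleton (suc u) (suc i) = trans (lookup-singleton u i) (sym (==-suc i u))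

support-∷ : ∀ {n} (o : Op n) φ i → support (o ∷ φ) i ≡ Vec.lookup (opSupport o) i xor support φ i
support-∷ o φ i = Vec.lookup-zipWith _xor_ i (opSupport o) (sup φ)

opSupport-lc : ∀ {n} (u i : Fin n) → Vec.lookup (opSupport (lc u)) i ≡ (i == u)
opSupport-lc = lookup-singleton

opSupport-piv : ∀ {n} (u v i : Fin n) → Vec.lookup (opSupport (piv u v)) i ≡ pair u v i
opSupport-piv u v i = trans (Vec.lookup-zipWith _xor_ i ⁅ u ⁆ ⁅ v ⁆) (cong₂ _xor_ (lookup-singleton u i) (lookup-singleton v i))

run-ppt : ∀ {n} {G H : Graph n} {φ} → Symmetric G → G ⟶[ φ ] H → PrincipalPivot G (support φ) H
run-ppt G-sym done = ppt-cong-subset (λ i → sym (Vec.lookup-replicate i false)) ppt-empty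
run-ppt {G = G} {φ = lc u ∷ φ} G-sym (stepLC Guu rest) =
  ppt-cong-subset (λ i → trans (cong (_xor support φ i) (sym (opSupport-lc u i))) (sym (support-∷ (lc u) φ i)))
    (ppt-compose (localComp-ppt G u G-sym Guu) (run-ppt (localComp-symmetric G u G-sym) rest))
run-ppt {G = G} {φ = piv u v ∷ φ} G-sym (stepPiv defined rest) =
  ppt-cong-subset (λ i → trans (cong (_xor support φ i) (sym (opSupport-piv u v i))) (sym (support-∷ (piv u v) φ i)))
    (ppt-compose (pivot-ppt G u v G-sym defined) (run-ppt (pivot-symmetric G u v G-sym) rest))

same-support-same-result : ∀ {n} {G H H' : Graph n} {φ φ'} → Symmetric G →
                           G ⟶[ φ ] H → G ⟶[ φ' ] H' → sup φ ≡ sup φ' → H ≈G H'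
same-support-same-result G-sym run run' same-sup with run-ppt G-sym run | run-ppt G-sym run'
... | GH , HG | GH' , _ =
  exchange-unique GH HG (exchange-cong-subset (λ i → cong (λ S → Vec.lookup S i) (sym same-sup)) GH')

NonsingularOn : ∀ {n} → Graph n → (Fin n → Bool) → Set
NonsingularOn {n} A X = ∀ (x : Fin n → Bool) → (∀ i → X i ≡ false → x i ≡ false) →
                        (∀ i → X i ≡ true → (A · x) i ≡ false) → ∀ i → x i ≡ false

exchange-nonsingular : ∀ {n} {A B : Graph n} {X : Fin n → Bool} → Exchange A X B → NonsingularOn A X
exchange-nonsingular {A = A} {B} {X} ex x outside kills i with X i in Xi
... | false = outside i Xi
... | true = begin
  x i                           ≡⟨ sym (cong (λ b → if b then x i else (A · x) i) Xi) ⟩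
  mix X x (A · x) i             ≡⟨ sym (ex x i) ⟩
  (B · mix X (A · x) x) i       ≡⟨ ⨁-zero _ (λ c → trans (cong (B i c ∧_) (w≡0 c)) (∧-zeroʳ (B i c))) ⟩
  false                         ∎
  where
  w≡0 : ∀ c → mix X (A · x) x c ≡ false
  w≡0 c with X c in Xc
  ... | true = kills c Xc
  ... | false = outside c Xc

nonsingular-after : ∀ {n} {A B : Graph n} {X Y : Fin n → Bool} → Exchange B Y A →
                    (∀ i → Y i ≡ true → X i ≡ true) → NonsingularOn A X → NonsingularOn B (X minus Y)
nonsingular-after {n} {A} {B} {X} {Y} ex Y⊆X nonsing x outside kills i with Y i in Yi
... | true = outside i (minus-inside X Y Yi)
... | false = trans (sym (cong (λ b → if b then (B · x) i else x i) Yi)) (z≡0 i)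
  where
  -- z = mix Y (B x) x is supported in X and killed by the rows of A in X.
  z : Fin n → Bool
  z = mix Y (B · x) x
  z-outside : ∀ c → X c ≡ false → z c ≡ false
  z-outside c Xc with Y c in Yc
  ... | true with trans (sym (Y⊆X c Yc)) Xc
  ...   | ()
  z-outside c Xc | false = outside c (trans (minus-outside X Y Yc) Xc)
  z-kills : ∀ c → X c ≡ true → (A · z) c ≡ false
  z-kills c Xc with ex x c
  ... | Az≡ with Y c in Yc
  ...   | true = trans Az≡ (outside c (minus-inside X Y Yc))
  ...   | false = trans Az≡ (kills c (trans (minus-outside X Y Yc) Xc))
  z≡0 : ∀ c → z c ≡ false
  z≡0 = nonsing z z-outside z-kills

record Realisation {n} (G : Graph n) (X : Fin n → Bool) : Set where
  field
    ops     : List (Op n)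
    result  : Graph n
    reduced : Reduced ops
    inside  : All (λ w → X w ≡ true) (vertices ops)
    run     : G ⟶[ ops ] result
    exact   : ∀ i → support ops i ≡ X i

realise-empty : ∀ {n} (G : Graph n) X → (∀ i → X i ≡ false) → Realisation G X
realise-empty G X X≡∅ = record
  { ops = [] ; result = G ; reduced = [] ; inside = [] ; run = done
  ; exact = λ i → trans (Vec.lookup-replicate i false) (sym (X≡∅ i)) }

xor-minus : ∀ {x y} → (y ≡ true → x ≡ true) → y xor (x ∧ not y) ≡ x
xor-minus {x} {false} _ = ∧-identityʳ x
xor-minus {x} {true} y⊆x = trans (cong not (∧-zeroʳ x)) (sym (y⊆x refl))

prepend : ∀ {n} {G G′ : Graph n} {X Y : Fin n → Bool} (o : Op n) →
          (∀ {φ H} → G′ ⟶[ φ ] H → G ⟶[ o ∷ φ ] H) →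
          (∀ i → Vec.lookup (opSupport o) i ≡ Y i) → (∀ i → Y i ≡ true → X i ≡ true) →
          Unique (opVertices o) → All (λ w → Y w ≡ true) (opVertices o) →
          Realisation G′ (X minus Y) → Realisation G X
prepend {X = X} {Y} o step supp-o Y⊆X unique-o inside-o R = record
  { ops = o ∷ ops
  ; result = result
  ; reduced = Unique.++⁺ unique-o reduced disjoint
  ; inside = All.++⁺ (All.map (λ {w} → Y⊆X w) inside-o) (All.map (λ {w} → ∧-conicalˡ (X w) (not (Y w))) inside)
  ; run = step run
  ; exact = λ i → trans (support-∷ o ops i) (trans (cong₂ _xor_ (supp-o i) (exact i)) (xor-minus (Y⊆X i)))
  }
  where
  open Realisation R
  disjoint : Disjoint (opVertices o) (vertices ops)
  disjoint {w} (w∈o , w∈ops) with trans (sym (minus-inside X Y (All.lookup inside-o w∈o))) (All.lookup inside w∈ops)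
  ... | ()

realise-loop : ∀ {n} {G : Graph n} {X : Fin n → Bool} u → X u ≡ true → G u u ≡ true →
               Realisation (localComp G u) (X minus (_== u)) → Realisation G X
realise-loop {X = X} u Xu Guu =
  prepend (lc u) (stepLC Guu) (opSupport-lc u) (singleton⊆ X Xu) ([] ∷ []) (==-refl u ∷ [])

pair⊆ : ∀ {n} (X : Fin n → Bool) {u v} → X u ≡ true → X v ≡ true → ∀ i → pair u v i ≡ true → X i ≡ true
pair⊆ X {u} {v} Xu Xv i pair-i with i == u in i==u
... | true = singleton⊆ X Xu i i==u
... | false = singleton⊆ X Xv i pair-i

realise-edge : ∀ {n} {G : Graph n} {X : Fin n → Bool} u v → X u ≡ true → X v ≡ true → PivotDefined G u v →
               Realisation (pivot G u v) (X minus pair u v) → Realisation G X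
realise-edge {X = X} u v Xu Xv defined@(_ , u≢v , _) =
  prepend (piv u v) (stepPiv defined) (opSupport-piv u v) (pair⊆ X Xu Xv)
          ((u≢v ∷ []) ∷ [] ∷ []) (pair-left u≢v ∷ pair-right u≢v ∷ [])

-- In a nonsingular G[X] no vertex of X is isolated within X (else e_u ∈ ker G[X]).
no-isolated : ∀ {n} {G : Graph n} {X : Fin n → Bool} → Symmetric G → NonsingularOn G X →
              ∀ u → X u ≡ true → (∀ v → X v ∧ G u v ≡ false) → ⊥
no-isolated {G = G} {X} G-sym nonsing u Xu isolated = unit-nonzero (nonsing (_== u) outside kills u)
  where
  unit-nonzero : (u == u) ≡ false → ⊥
  unit-nonzero u==u with trans (sym (==-refl u)) u==u
  ... | ()
  outside : ∀ i → X i ≡ false → (i == u) ≡ false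
  outside i Xi with i == u in i==u
  ... | false = refl
  ... | true with trans (sym (singleton⊆ X Xu i i==u)) Xi
  ...   | ()
  kills : ∀ i → X i ≡ true → (G · (_== u)) i ≡ false
  kills i Xi = trans (⨁-unitʳ u (G i)) (trans (G-sym i u) (trans (sym (cong (_∧ G u i) Xi)) (isolated i)))

loopless-edge : ∀ {n} {G : Graph n} {X : Fin n → Bool} → (∀ w → X w ∧ G w w ≡ false) →
                ∀ u v → X u ≡ true → X v ≡ true → G u v ≡ true → PivotDefined G u v
loopless-edge {G = G} {X} loopless u v Xu Xv Guv = Guv , u≢v , loop-free u Xu , loop-free v Xv
  where
  loop-free : ∀ w → X w ≡ true → G w w ≡ false
  loop-free w Xw = trans (sym (cong (_∧ G w w) Xw)) (loopless w)
  u≢v : u ≢ v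
  u≢v refl with trans (sym (loop-free u Xu)) Guv
  ... | ()

-- The greedy construction: while X is nonempty, use a looped vertex of X if
-- there is one, and otherwise an edge inside X; nonsingularity of G[X] is
-- preserved, and ensures that such an edge exists.  m bounds |X|.
realise : ∀ {n} m (G : Graph n) (X : Fin n → Bool) → Symmetric G → NonsingularOn G X → count X ≤ m → Realisation G X
realise zero G X _ _ count≤0 = realise-empty G X X≡∅
  where
  X≡∅ : ∀ i → X i ≡ false
  X≡∅ i with X i in Xi
  ... | false = refl
  ... | true = ⊥-elim (<⇒≱ (count-positive X i Xi) count≤0)
realise (suc m) G X G-sym nonsing count≤m with search (λ i → X i ∧ G i i)
... | inj₁ (u , Xu∧Guu) =
  realise-loop u Xu Guu (realise m (localComp G u) (X minus (_== u)) (localComp-symmetric G u G-sym)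
    (nonsingular-after (proj₂ (localComp-ppt G u G-sym Guu)) (singleton⊆ X Xu) nonsing)
    (count-step X (_== u) count≤m (singleton⊆ X Xu) u (==-refl u)))
  where
  Xu : X u ≡ true
  Xu = ∧-conicalˡ (X u) (G u u) Xu∧Guu
  Guu : G u u ≡ true
  Guu = ∧-conicalʳ (X u) (G u u) Xu∧Guu
... | inj₂ loopless with search X
...   | inj₂ X≡∅ = realise-empty G X X≡∅
...   | inj₁ (u , Xu) with search (λ v → X v ∧ G u v)
...     | inj₂ isolated = ⊥-elim (no-isolated G-sym nonsing u Xu isolated)
...     | inj₁ (v , Xv∧Guv) =
  realise-edge u v Xu Xv defined (realise m (pivot G u v) (X minus pair u v) (pivot-symmetric G u v G-sym)
    (nonsingular-after (proj₂ (pivot-ppt G u v G-sym defined)) (pair⊆ X Xu Xv) nonsing)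
    (count-step X (pair u v) count≤m (pair⊆ X Xu Xv) u (pair-left u≢v)))
  where
  Xv : X v ≡ true
  Xv = ∧-conicalˡ (X v) (G u v) Xv∧Guv
  defined : PivotDefined G u v
  defined = loopless-edge loopless u v Xu Xv (∧-conicalʳ (X v) (G u v) Xv∧Guv)
  u≢v : u ≢ v
  u≢v = proj₁ (proj₂ defined)

sumList-filter : ∀ {n} (p f : Fin n → Bool) (L : List (Fin n)) → (∀ a → p a ≡ false → f a ≡ false) →
                 sumList (map f (filter (λ i → T? (p i)) L)) ≡ sumList (map f L)
sumList-filter p f [] vanish = refl
sumList-filter p f (a ∷ L) vanish with p a in pa
... | true = cong (f a xor_) (sumList-filter p f L vanish)
... | false = trans (sumList-filter p f L vanish) (sym (cong (_xor sumList (map f L)) (vanish a pa)))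

lookup-injective : ∀ {A : Set} {L : List A} → Unique L → ∀ b b' → lookup L b ≡ lookup L b' → b ≡ b'
lookup-injective (_ ∷ _) zero zero _ = refl
lookup-injective (a∉L ∷ _) zero (suc b') e = ⊥-elim (All.lookup a∉L (∈-lookup b') e)
lookup-injective (a∉L ∷ _) (suc b) zero e = ⊥-elim (All.lookup a∉L (∈-lookup b) (sym e))
lookup-injective (_ ∷ unique) (suc b) (suc b') e = cong suc (lookup-injective unique b b' e)

module InducedSubgraph {n : ℕ} (G : Graph n) (S : Subset n) where

  X : Fin n → Bool
  X = Vec.lookup S

  k : ℕ
  k = length (elems S)

  e : Fin k → Fin n
  e = lookup (elems S)

  e-inside : ∀ b → X (e b) ≡ true
  e-inside b = Equivalence.to T-≡ (proj₂ (∈-filter⁻ (λ i → T? (X i)) {xs = allFin n} (∈-lookup b)))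

  e-onto : ∀ i → X i ≡ true → ∃ λ b → e b ≡ i
  e-onto i Xi = index i∈E , sym (lookup-index i∈E)
    where
    i∈E : i ∈ elems S
    i∈E = ∈-filter⁺ (λ i → T? (X i)) (∈-allFin i) (Equivalence.from T-≡ Xi)

  e-injective : ∀ b b' → e b ≡ e b' → b ≡ b'
  e-injective = lookup-injective (Unique.filter⁺ (λ i → T? (X i)) (Unique.allFin⁺ n))

  sum-over-S : ∀ (f : Fin n → Bool) → (∀ i → X i ≡ false → f i ≡ false) → ⨁ f ≡ ⨁ (f ∘ e)
  sum-over-S f vanish = begin
    ⨁ f                                                  ≡⟨ ⨁-allFin f ⟩
    sumList (map f (allFin n))                           ≡⟨ sym (sumList-filter X f (allFin n) vanish) ⟩
    sumList (map f (elems S))                            ≡⟨ sym (⨁-lookup f (elems S)) ⟩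
    ⨁ (f ∘ e)                                            ∎

  extend : (Fin k → Bool) → Fin n → Bool
  extend x' i = ⨁ (λ b → (e b == i) ∧ x' b)

  extend-outside : ∀ x' i → X i ≡ false → extend x' i ≡ false
  extend-outside x' i Xi = ⨁-zero _ term
    where
    term : ∀ b → (e b == i) ∧ x' b ≡ false
    term b with e b == i in eb==i
    ... | false = refl
    ... | true with trans (sym (singleton⊆ X (e-inside b) i (trans (==-sym i (e b)) eb==i))) Xi
    ...   | ()

  extend-e : ∀ x' b → extend x' (e b) ≡ x' b
  extend-e x' b = trans (⨁-cong (λ b' → cong (_∧ x' b') (same-test b'))) (⨁-unitˡ b x')
    where
    same-test : ∀ b' → (e b' == e b) ≡ (b' == b)
    same-test b' with b' ≟ b
    ... | yes refl = ==-refl (e b')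
    ... | no b'≢b = ==-≢ (b'≢b ∘ e-injective b' b)

  ·-extend : ∀ x' r → (G · extend x') r ≡ ⨁ (λ b → G r (e b) ∧ x' b)
  ·-extend x' r = begin
    ⨁ (λ c → G r c ∧ ⨁ (λ b → (e b == c) ∧ x' b))
      ≡⟨ ⨁-cong (λ c → sym (⨁-scaleˡ (G r c) (λ b → (e b == c) ∧ x' b))) ⟩
    ⨁ (λ c → ⨁ (λ b → G r c ∧ ((e b == c) ∧ x' b)))
      ≡⟨ ⨁-swap (λ c b → G r c ∧ ((e b == c) ∧ x' b)) ⟩
    ⨁ (λ b → ⨁ (λ c → G r c ∧ ((e b == c) ∧ x' b)))
      ≡⟨ ⨁-cong (λ b → trans (⨁-cong (λ c → regroup (G r c) (e b == c) (x' b) (==-sym (e b) c)))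
                              (⨁-unitˡ (e b) (λ c → G r c ∧ x' b))) ⟩
    ⨁ (λ b → G r (e b) ∧ x' b) ∎
    where
    regroup : ∀ g t x {t'} → t ≡ t' → g ∧ (t ∧ x) ≡ t' ∧ (g ∧ x)
    regroup false t x refl = sym (∧-zeroʳ t)
    regroup true t x refl = refl

  nonsingular-of-injective : Injective (induced G S) → NonsingularOn G X
  nonsingular-of-injective inj x outside kills i with X i in Xi
  ... | false = outside i Xi
  ... | true with e-onto i Xi
  ...   | b , refl = inj (x ∘ e) kills′ b
    where
    kills′ : ∀ a → (induced G S · (x ∘ e)) a ≡ false
    kills′ a = trans (sym (sum-over-S (λ c → G (e a) c ∧ x c)
                                      (λ c Xc → trans (cong (G (e a) c ∧_) (outside c Xc)) (∧-zeroʳ _))))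
                     (kills (e a) (e-inside a))

  injective-of-nonsingular : NonsingularOn G X → Injective (induced G S)
  injective-of-nonsingular nonsing x' kills′ b = trans (sym (extend-e x' b)) (x≡0 (e b))
    where
    kills : ∀ r → X r ≡ true → (G · extend x') r ≡ false
    kills r Xr with e-onto r Xr
    ... | a , refl = trans (·-extend x' (e a)) (kills′ a)
    x≡0 : ∀ i → extend x' i ≡ false
    x≡0 = nonsing (extend x') (extend-outside x') kills

  det-nonsingular : det (induced G S) ≡ true → NonsingularOn G X
  det-nonsingular det≡true = nonsingular-of-injective (dichotomy-injective (det-dichotomy (induced G S)) det≡true)

  nonsingular-det : NonsingularOn G X → det (induced G S) ≡ true
  nonsingular-det nonsing with det-dichotomy (induced G S)
  ... | inj₁ (det≡true , _) = det≡true
  ... | inj₂ (_ , sing) = ⊥-elim (injective-nonsingular (injective-of-nonsingular nonsing) sing)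

realisation-of-nonsingular : ∀ {n} {G : Graph n} {X : Fin n → Bool} → Symmetric G → NonsingularOn G X → Realisation G X
realisation-of-nonsingular {G = G} {X} G-sym nonsing = realise (count X) G X G-sym nonsing ≤-refl

nonsingular-of-run : ∀ {n} {G H : Graph n} {φ} → Symmetric G → G ⟶[ φ ] H → NonsingularOn G (support φ)
nonsingular-of-run G-sym run = exchange-nonsingular (proj₁ (run-ppt G-sym run))

lookup-ext : ∀ {n} (S T : Subset n) → (∀ i → Vec.lookup S i ≡ Vec.lookup T i) → S ≡ T
lookup-ext S T S≗T = trans (sym (Vec.tabulate∘lookup S)) (trans (Vec.tabulate-cong S≗T) (Vec.tabulate∘lookup T))

reduced-sequence-of-det : ∀ {n} {G : Graph n} → Symmetric G → ∀ (S : Subset n) → det (induced G S) ≡ true →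
                          Σ (List (Op n)) (λ φ → Σ (Graph n) (λ H → Reduced φ × G ⟶[ φ ] H × sup φ ≡ S))
reduced-sequence-of-det {G = G} G-sym S det≡true = ops , result , reduced , run , lookup-ext (sup ops) S exact
  where open Realisation (realisation-of-nonsingular G-sym (InducedSubgraph.det-nonsingular G S det≡true))

det-of-sequence : ∀ {n} {G : Graph n} → Symmetric G → ∀ (S : Subset n) →
                  Σ (List (Op n)) (λ φ → Σ (Graph n) (λ H → G ⟶[ φ ] H × sup φ ≡ S)) → det (induced G S) ≡ true
det-of-sequence {G = G} G-sym S (_ , _ , run , sup≡S) =
  InducedSubgraph.nonsingular-det G S (subst (λ T → NonsingularOn G (Vec.lookup T)) sup≡S (nonsingular-of-run G-sym run))

theorem8 : ∀ {n : ℕ} (G : Graph n) → Symmetric G →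
    (∀ (φ φ' : List (Op n)) (H H' : Graph n) →
       G ⟶[ φ ] H → G ⟶[ φ' ] H' → sup φ ≡ sup φ' → H ≈G H')
    × (∀ (S : Subset n) →
       (det (induced G S) ≡ true →
          Σ (List (Op n)) (λ φ → Σ (Graph n) (λ H → Reduced φ × G ⟶[ φ ] H × sup φ ≡ S)))
       × (Σ (List (Op n)) (λ φ → Σ (Graph n) (λ H → G ⟶[ φ ] H × sup φ ≡ S)) →
          det (induced G S) ≡ true))
theorem8 G G-sym =
  (λ φ φ' H H' → same-support-same-result G-sym) ,
  (λ S → reduced-sequence-of-det G-sym S , det-of-sequence G-sym S)
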